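{- Let $\mathbb{F}_q$ be a finite field, $P,Q\in\mathbb{F}_q[X]\setminus\{0\}$ coprime with $\deg P>\deg Q$, $\mathcal{D}=\{s\in\mathbb{F}_q[X]:\deg s<\deg P\}$, and let $\mathcal{L}_{P/Q}=\{\langle w\rangle_{P/Q}: w\in\mathbb{F}_q[X]\}\subseteq\mathcal{D}^*$ be the language of digit strings. If $\deg Q\ge 1$, then $\mathcal{L}_{P/Q}$ is not a regular language (over the alphabet $\mathcal{D}$) and is not suffix-closed. Moreover (without the assumption $\deg Q\ge1$), $\mathcal{L}_{P/Q}$ is prefix-closed.
   Context: For $w\in\mathbb{F}_q[X]$ the digit string $\langle w\rangle_{P/Q}$ is computed as follows: put $w_0=w$ and for $i\ge 0$ let $s_i\in\mathcal{D}$ be the remainder of $Qw_i$ upon division by $P$ and $w_{i+1}=(Qw_i-s_i)/P\in\mathbb{F}_q[X]$ (so $Qw_i=Pw_{i+1}+s_i$); let $k\ge0$ be minimal such that $w_i=0$ for all $i>k$. Then $\langle w\rangle_{P/Q}=s_k s_{k-1}\cdots s_0$, a finite word over the alphabet $\mathcal{D}$ written with the most significant digit first; it satisfies $w=\sum_{i=0}^k\frac{s_i}{Q}(P/Q)^i$ (e.g. $\langle 0\rangle_{P/Q}=0$). A language is regular if it is accepted by a deterministic finite automaton. A language is prefix-closed (resp. suffix-closed) if it contains every nonempty prefix (resp. suffix) of each of its words. -}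

module Defs where

open import Data.Nat using (ℕ; zero; suc; _∸_; _<_; _≤_)
open import Data.Fin using (Fin)
open import Data.Bool using (Bool; true)
open import Data.List using (List; []; _∷_; length; reverse; foldl; _++_)
open import Data.Vec using (Vec; []; _∷_; fromList; toList; replicate; zipWith)
open import Data.Product using (Σ; ∃; _×_; _,_; proj₁; proj₂)
open import Relation.Nullary using (¬_; yes; no)
open import Relation.Binary.PropositionalEquality using (_≡_; _≢_)
open import Relation.Binary.Definitions using (DecidableEquality)
open import Algebra.Structures using (IsCommutativeRing)
open import Function.Bundles using (_↔_; _⇔_)

record FiniteField : Set₁ where
  infixl 6 _+_
  infixl 7 _*_
  field
    Carrier : Set
    _+_ _*_ : Carrier → Carrier → Carrier
    -_      : Carrier → Carrier
    0# 1#   : Carrier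
    _⁻¹     : Carrier → Carrier
    isCommutativeRing : IsCommutativeRing _≡_ _+_ _*_ -_ 0# 1#
    0≢1     : 0# ≢ 1#
    ⁻¹-inverse : ∀ x → x ≢ 0# → x * (x ⁻¹) ≡ 1#
    _≟_     : DecidableEquality Carrier
    finite  : Σ ℕ λ q → Carrier ↔ Fin q

-- Polynomials over 𝔽: coefficient lists, lowest degree first.
-- A list represents the polynomial Σ aᵢ Xⁱ; trailing zeros are allowed
-- in the representation, and two lists denote the same polynomial iff
-- their trims agree.

module Poly (𝔽 : FiniteField) where
  open FiniteField 𝔽

  F : Set
  F = Carrier

  Pol : Set
  Pol = List F

  cons⁰ : F → List F → List F
  cons⁰ x [] with x ≟ 0#
  ... | yes _ = []
  ... | no  _ = x ∷ []
  cons⁰ x (y ∷ ys) = x ∷ y ∷ ys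

  trim : Pol → Pol
  trim []       = []
  trim (x ∷ xs) = cons⁰ x (trim xs)

  _≈_ : Pol → Pol → Set
  p ≈ q = trim p ≡ trim q

  IsZero : Pol → Set
  IsZero p = trim p ≡ []

  0p 1p : Pol
  0p = []
  1p = 1# ∷ []

  -- degree (of a nonzero polynomial; the value 0 is returned for 0)
  deg′ : List F → ℕ
  deg′ []       = 0
  deg′ (x ∷ xs) = length xs

  deg : Pol → ℕ
  deg p = deg′ (trim p)

  _⊕_ : Pol → Pol → Pol
  []       ⊕ q        = q
  (a ∷ p)  ⊕ []       = a ∷ p
  (a ∷ p)  ⊕ (b ∷ q)  = (a + b) ∷ (p ⊕ q)

  scale : F → Pol → Pol
  scale c []       = []
  scale c (a ∷ p)  = c * a ∷ scale c p

  _⊛_ : Pol → Pol → Pol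
  []      ⊛ q = []
  (a ∷ p) ⊛ q = scale a q ⊕ (0# ∷ (p ⊛ q))

  _∣_ : Pol → Pol → Set
  d ∣ p = ∃ λ c → (c ⊛ d) ≈ p

  Coprime : Pol → Pol → Set
  Coprime p q = ∀ d → d ∣ p → d ∣ q → d ∣ 1p

  -- Euclidean division by a polynomial (long division, Horner scheme).
  -- Remainders of division by P are coefficient vectors of length deg P,
  -- i.e. exactly the polynomials s with deg s < deg P.

  lastV : ∀ {n} → Vec F (suc n) → F
  lastV (x ∷ [])     = x
  lastV (x ∷ y ∷ ys) = lastV (y ∷ ys)

  initV : ∀ {n} → Vec F (suc n) → Vec F n
  initV (x ∷ [])     = []
  initV (x ∷ y ∷ ys) = x ∷ initV (y ∷ ys)

  -- one step: remainder r, next coefficient a (processed high to low);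
  -- returns the next quotient coefficient and new remainder.
  divStep : ∀ {n} → Vec F (suc n) → Vec F n → F → F × Vec F n
  divStep Pv r a =
    let sh = a ∷ r
        c  = lastV sh * (lastV Pv ⁻¹)
        nw = zipWith (λ x p → x + - (c * p)) sh Pv
    in c , initV nw

  -- divide a polynomial given by its coefficients high-first;
  -- accumulates quotient coefficients low-first.
  divLoop : ∀ {n} → Vec F (suc n) → List F → List F → Vec F n → List F × Vec F n
  divLoop Pv []       acc r = acc , r
  divLoop Pv (a ∷ as) acc r with divStep Pv r a
  ... | c , r′ = divLoop Pv as (c ∷ acc) r′

  divModL : (Pt : List F) → Pol → Pol × Vec F (deg′ Pt)
  divModL []       a = [] , []
  divModL (p ∷ ps) a =
    divLoop (fromList (p ∷ ps)) (reverse a) [] (replicate _ 0#)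

  divMod : (P : Pol) → Pol → Pol × Vec F (deg P)
  divMod P a = divModL (trim P) a

  Digit : Pol → Set
  Digit P = Vec F (deg P)

  module Expansion (P Q w : Pol) where
    -- w_i and s_i :  Q w_i = P w_{i+1} + s_i
    wₛ : ℕ → Pol
    sₛ : ℕ → Digit P
    wₛ zero    = w
    wₛ (suc i) = proj₁ (divMod P (Q ⊛ wₛ i))
    sₛ i       = proj₂ (divMod P (Q ⊛ wₛ i))

    -- s_k s_{k-1} ... s_0  (most significant digit first)
    digitsTo : ℕ → List (Digit P)
    digitsTo zero    = sₛ zero ∷ []
    digitsTo (suc k) = sₛ (suc k) ∷ digitsTo k

    VanishesAfter : ℕ → Set
    VanishesAfter k = ∀ i → k < i → IsZero (wₛ i)

  IsDigitString : (P Q w : Pol) → List (Digit P) → Set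
  IsDigitString P Q w ds =
    Σ ℕ λ k → ds ≡ digitsTo k × VanishesAfter k
              × (∀ k′ → k′ < k → ¬ VanishesAfter k′)
    where open Expansion P Q w

  Lang : (P Q : Pol) → List (Digit P) → Set
  Lang P Q ds = ∃ λ w → IsDigitString P Q w ds

record DFA (A : Set) : Set where
  field
    states : ℕ
    δ      : Fin states → A → Fin states
    start  : Fin states
    accept : Fin states → Bool

  run : Fin states → List A → Fin states
  run q []       = q
  run q (a ∷ as) = run (δ q a) as

  Accepts : List A → Set
  Accepts ws = accept (run start ws) ≡ true

Regular : {A : Set} → (List A → Set) → Set
Regular {A} L = Σ (DFA A) λ M → ∀ ws → L ws ⇔ DFA.Accepts M ws

PrefixClosed : {A : Set} → (List A → Set) → Set
PrefixClosed L = ∀ u v → L (u ++ v) → u ≢ [] → L u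

SuffixClosed : {A : Set} → (List A → Set) → Set
SuffixClosed L = ∀ u v → L (u ++ v) → v ≢ [] → L v

module Submission where

-- Reading a digit s leads from y to y′ when Q y′ = P y + s, and ⟨w⟩ is the
-- digit path ending at w.  Cutting such a path shows that every nonempty
-- prefix of ⟨w⟩ is again an expansion (prefix-closure), and comparing two
-- readings of the same digits x gives  Q^|x| (z − z′) = P^|x| (y − y′),
-- whence expansions are injective.  As deg Q < deg P, every expansion can
-- be continued by the digit −P y mod Q; starting from 1 this produces
-- polynomials g_n whose expansions G_n extend each other.  If G_a x were an
-- expansion for a continuation x of G_b, coprimality would force
-- Q^|x| ∣ g_b − g_a ≠ 0, impossible by degrees when |x| > deg (g_b − g_a)
-- and deg Q ≥ 1; so the G_n are pairwise separated and L is not regular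
-- (Myhill–Nerode).  Finally ⟨g_1⟩ = Q s, and the suffix s being an
-- expansion would give Q ∣ P.

open import Defs
open import Data.Nat using (_<_; _≤_)
open import Data.Product using (_×_)
open import Relation.Nullary using (¬_)

open import Level using (0ℓ)
open import Data.Bool using (true)
open import Data.Empty using (⊥-elim)
open import Data.Fin using (toℕ)
open import Data.Fin.Properties using (pigeonhole)
open import Data.List using (List; []; _∷_; _++_; length; reverse; reverseAcc)
open import Data.List.Properties
  using (reverse-involutive; ++-assoc; ++-identityʳ; ∷-injective; ∷-injectiveˡ; ∷-injectiveʳ;
         length-++)
open import Data.Nat using (ℕ; zero; suc; z≤n; s≤s; _∸_) renaming (_+_ to _+ₙ_)
open import Data.Nat.Properties
  using (≤-refl; ≤-trans; ≤-<-trans; ≤-pred; <⇒≤; <-cmp; <-irrefl; m≤n+m; m≤m+n; n≤1+n; n<1+n;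
         suc-injective; +-comm; +-identityʳ; +-suc; +-mono-≤; +-monoˡ-<; m≤n⇒m<n∨m≡n;
         m∸n+n≡m; m+n∸n≡m; ∸-monoˡ-<)
import Data.Product as Product
open import Data.Product using (Σ; _,_; proj₁; proj₂)
open import Data.Sum using (inj₁; inj₂)
open import Data.Vec using (Vec; []; _∷_; toList; fromList; replicate; zipWith)
open import Data.Vec.Properties using (length-toList; toList∘fromList)
open import Function using (case_of_; id; _∘_)
open import Function.Bundles using (Equivalence)
open import Relation.Nullary using (Dec; yes; no)
open import Relation.Binary.Definitions using (tri<; tri≈; tri>)
open import Relation.Binary.PropositionalEquality
open import Relation.Binary.Bundles using (Setoid)
open import Relation.Binary.Structures using (IsEquivalence)
import Relation.Binary.Reasoning.Setoid
open import Algebra.Bundles using (CommutativeRing)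

++-split : ∀ {A : Set} (u u′ x x′ : List A) → length u ≡ length u′ → u ++ x ≡ u′ ++ x′ →
           u ≡ u′ × x ≡ x′
++-split []      []       x x′ _   e = refl , e
++-split (a ∷ u) (b ∷ u′) x x′ |u| e with ∷-injective e
... | refl , e′ = Product.map (cong (a ∷_)) id (++-split u u′ x x′ (suc-injective |u|) e′)

run-++ : ∀ {A : Set} (M : DFA A) q u v → DFA.run M q (u ++ v) ≡ DFA.run M (DFA.run M q u) v
run-++ M q []      v = refl
run-++ M q (a ∷ u) v = run-++ M (DFA.δ M q a) u v

-- Two of them lead any automaton to the
-- same state (pigeonhole), and then it cannot separate them.
separated⇒¬regular : ∀ {A : Set} (L : List A → Set) (word : ℕ → List A) →
  (∀ {a b} → a < b → Σ (List A) λ x → L (word b ++ x) × ¬ L (word a ++ x)) → ¬ Regular L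
separated⇒¬regular L word separated (M , L⇔M)
  with pigeonhole (n<1+n (DFA.states M)) (λ i → DFA.run M (DFA.start M) (word (toℕ i)))
... | i , j , i<j , same-state = ¬La (Equivalence.from (L⇔M _) accepts-a)
  where
  open DFA M
  x   = proj₁ (separated i<j)
  Lb  = proj₁ (proj₂ (separated i<j))
  ¬La = proj₂ (proj₂ (separated i<j))
  accepts-a : Accepts (word (toℕ i) ++ x)
  accepts-a = begin
    accept (run start (word (toℕ i) ++ x))          ≡⟨ cong accept (run-++ M start (word (toℕ i)) x) ⟩
    accept (run (run start (word (toℕ i))) x)       ≡⟨ cong (λ q → accept (run q x)) same-state ⟩
    accept (run (run start (word (toℕ j))) x)       ≡⟨ cong accept (run-++ M start (word (toℕ j)) x) ⟨
    accept (run start (word (toℕ j) ++ x))          ≡⟨ Equivalence.to (L⇔M _) Lb ⟩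
    true                                            ∎
    where open ≡-Reasoning

-- Two lists are identified when all
-- their coefficients agree; under this equality ⊕, ⊛ and negation form a
-- commutative ring, which lets the rest of the development use
-- the library's ring theory and setoid reasoning.
module Arithmetic (𝔽 : FiniteField) where
  open FiniteField 𝔽
  open Poly 𝔽

  fieldRing : CommutativeRing 0ℓ 0ℓ
  fieldRing = record { isCommutativeRing = isCommutativeRing }
  module R = CommutativeRing fieldRing
  open import Algebra.Properties.CommutativeSemigroup R.+-commutativeSemigroup
    using (interchange)
  open ≡-Reasoning

  *-nonzero : ∀ {a b} → a ≢ 0# → b ≢ 0# → a * b ≢ 0#
  *-nonzero {a} {b} a≢0 b≢0 ab≡0 = b≢0 (begin
    b                   ≡⟨ sym (R.*-identityˡ b) ⟩
    1# * b              ≡⟨ cong (_* b) (sym (⁻¹-inverse a a≢0)) ⟩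
    (a * a ⁻¹) * b      ≡⟨ cong (_* b) (R.*-comm a (a ⁻¹)) ⟩
    (a ⁻¹ * a) * b      ≡⟨ R.*-assoc _ _ _ ⟩
    a ⁻¹ * (a * b)      ≡⟨ cong (a ⁻¹ *_) ab≡0 ⟩
    a ⁻¹ * 0#           ≡⟨ R.zeroʳ _ ⟩
    0#                  ∎)

  y+[x-y]≡x : ∀ x y → y + (x + - y) ≡ x
  y+[x-y]≡x x y = begin
    y + (x + - y)  ≡⟨ cong (y +_) (R.+-comm x (- y)) ⟩
    y + (- y + x)  ≡⟨ R.+-assoc _ _ _ ⟨
    (y + - y) + x  ≡⟨ cong (_+ x) (R.-‿inverseʳ y) ⟩
    0# + x         ≡⟨ R.+-identityˡ x ⟩
    x              ∎

  coeff : Pol → ℕ → F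
  coeff []      n       = 0#
  coeff (a ∷ p) zero    = a
  coeff (a ∷ p) (suc n) = coeff p n

  -- Coefficientwise equality (a record, so that its argument lists are
  -- recoverable by unification).
  infix 4 _≋_
  record _≋_ (p q : Pol) : Set where
    constructor pw
    field at : ∀ n → coeff p n ≡ coeff q n
  open _≋_ public

  ≋-isEquivalence : IsEquivalence _≋_
  ≋-isEquivalence = record
    { refl  = pw λ n → refl
    ; sym   = λ e → pw λ n → sym (at e n)
    ; trans = λ e f → pw λ n → trans (at e n) (at f n)
    }

  ≋-setoid : Setoid 0ℓ 0ℓ
  ≋-setoid = record { isEquivalence = ≋-isEquivalence }

  module ≋-Reasoning = Relation.Binary.Reasoning.Setoid ≋-setoid

  open IsEquivalence ≋-isEquivalence public
    renaming (refl to ≋-refl; sym to ≋-sym; trans to ≋-trans)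

  ≡⇒≋ : ∀ {p q} → p ≡ q → p ≋ q
  ≡⇒≋ refl = ≋-refl

  ∷-cong : ∀ {a b p q} → a ≡ b → p ≋ q → a ∷ p ≋ b ∷ q
  ∷-cong e f = pw λ { zero → e ; (suc n) → at f n }

  zero-constant : 0# ∷ [] ≋ []
  zero-constant = pw λ { zero → refl ; (suc n) → refl }

  hd : Pol → F
  hd p = coeff p 0

  tl : Pol → Pol
  tl []      = []
  tl (a ∷ p) = p

  coeff-tl : ∀ p n → coeff (tl p) n ≡ coeff p (suc n)
  coeff-tl []      n = refl
  coeff-tl (a ∷ p) n = refl

  tl-cong : ∀ {p q} → p ≋ q → tl p ≋ tl q
  tl-cong {p} {q} e = pw λ n →
    trans (coeff-tl p n) (trans (at e (suc n)) (sym (coeff-tl q n)))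

  hd-tl : ∀ p → hd p ∷ tl p ≋ p
  hd-tl []      = zero-constant
  hd-tl (a ∷ p) = ≋-refl

  coeff-⊕ : ∀ p q n → coeff (p ⊕ q) n ≡ coeff p n + coeff q n
  coeff-⊕ []      q       n       = sym (R.+-identityˡ _)
  coeff-⊕ (a ∷ p) []      n       = sym (R.+-identityʳ _)
  coeff-⊕ (a ∷ p) (b ∷ q) zero    = refl
  coeff-⊕ (a ∷ p) (b ∷ q) (suc n) = coeff-⊕ p q n

  coeff-scale : ∀ c p n → coeff (scale c p) n ≡ c * coeff p n
  coeff-scale c []      n       = sym (R.zeroʳ c)
  coeff-scale c (a ∷ p) zero    = refl
  coeff-scale c (a ∷ p) (suc n) = coeff-scale c p n

  coeff-⊛-zero : ∀ p q → coeff (p ⊛ q) 0 ≡ hd p * hd q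
  coeff-⊛-zero []      q = sym (R.zeroˡ _)
  coeff-⊛-zero (a ∷ p) q = begin
    coeff (scale a q ⊕ (0# ∷ (p ⊛ q))) 0  ≡⟨ coeff-⊕ (scale a q) (0# ∷ (p ⊛ q)) 0 ⟩
    coeff (scale a q) 0 + 0#              ≡⟨ R.+-identityʳ _ ⟩
    coeff (scale a q) 0                   ≡⟨ coeff-scale a q 0 ⟩
    a * hd q                              ∎

  coeff-⊛-suc : ∀ p q n →
    coeff (p ⊛ q) (suc n) ≡ hd p * coeff q (suc n) + coeff (tl p ⊛ q) n
  coeff-⊛-suc []      q n = sym (trans (cong (_+ 0#) (R.zeroˡ _)) (R.+-identityʳ 0#))
  coeff-⊛-suc (a ∷ p) q n =
    trans (coeff-⊕ (scale a q) (0# ∷ (p ⊛ q)) (suc n))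
          (cong (_+ coeff (p ⊛ q) n) (coeff-scale a q (suc n)))

  ⊕-cong : ∀ {p p′ q q′} → p ≋ p′ → q ≋ q′ → p ⊕ q ≋ p′ ⊕ q′
  ⊕-cong {p} {p′} {q} {q′} e f = pw λ n → begin
    coeff (p ⊕ q) n            ≡⟨ coeff-⊕ p q n ⟩
    coeff p n + coeff q n      ≡⟨ cong₂ _+_ (at e n) (at f n) ⟩
    coeff p′ n + coeff q′ n    ≡⟨ coeff-⊕ p′ q′ n ⟨
    coeff (p′ ⊕ q′) n          ∎

  ⊕-comm : ∀ p q → p ⊕ q ≋ q ⊕ p
  ⊕-comm p q = pw λ n →
    trans (coeff-⊕ p q n) (trans (R.+-comm _ _) (sym (coeff-⊕ q p n)))

  ⊕-assoc : ∀ p q r → (p ⊕ q) ⊕ r ≋ p ⊕ (q ⊕ r)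
  ⊕-assoc p q r = pw λ n → begin
    coeff ((p ⊕ q) ⊕ r) n                ≡⟨ coeff-⊕ (p ⊕ q) r n ⟩
    coeff (p ⊕ q) n + coeff r n          ≡⟨ cong (_+ coeff r n) (coeff-⊕ p q n) ⟩
    (coeff p n + coeff q n) + coeff r n  ≡⟨ R.+-assoc _ _ _ ⟩
    coeff p n + (coeff q n + coeff r n)  ≡⟨ cong (coeff p n +_) (coeff-⊕ q r n) ⟨
    coeff p n + coeff (q ⊕ r) n          ≡⟨ coeff-⊕ p (q ⊕ r) n ⟨
    coeff (p ⊕ (q ⊕ r)) n                ∎

  ⊕-interchange : ∀ p q r s → (p ⊕ q) ⊕ (r ⊕ s) ≋ (p ⊕ r) ⊕ (q ⊕ s)
  ⊕-interchange p q r s = pw λ n → begin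
    coeff ((p ⊕ q) ⊕ (r ⊕ s)) n
      ≡⟨ trans (coeff-⊕ (p ⊕ q) (r ⊕ s) n) (cong₂ _+_ (coeff-⊕ p q n) (coeff-⊕ r s n)) ⟩
    (coeff p n + coeff q n) + (coeff r n + coeff s n)
      ≡⟨ interchange _ _ _ _ ⟩
    (coeff p n + coeff r n) + (coeff q n + coeff s n)
      ≡⟨ trans (coeff-⊕ (p ⊕ r) (q ⊕ s) n) (cong₂ _+_ (coeff-⊕ p r n) (coeff-⊕ q s n)) ⟨
    coeff ((p ⊕ r) ⊕ (q ⊕ s)) n
      ∎

  ⊕-identityʳ : ∀ p → p ⊕ [] ≋ p
  ⊕-identityʳ []      = ≋-refl
  ⊕-identityʳ (a ∷ p) = ≋-refl

  scale-cong : ∀ {c p q} → p ≋ q → scale c p ≋ scale c q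
  scale-cong {c} {p} {q} e = pw λ n →
    trans (coeff-scale c p n) (trans (cong (c *_) (at e n)) (sym (coeff-scale c q n)))

  scale-⊕ : ∀ c p q → scale c (p ⊕ q) ≋ scale c p ⊕ scale c q
  scale-⊕ c p q = pw λ n → begin
    coeff (scale c (p ⊕ q)) n                  ≡⟨ coeff-scale c (p ⊕ q) n ⟩
    c * coeff (p ⊕ q) n                        ≡⟨ cong (c *_) (coeff-⊕ p q n) ⟩
    c * (coeff p n + coeff q n)                ≡⟨ R.distribˡ c _ _ ⟩
    c * coeff p n + c * coeff q n              ≡⟨ cong₂ _+_ (coeff-scale c p n) (coeff-scale c q n) ⟨
    coeff (scale c p) n + coeff (scale c q) n  ≡⟨ coeff-⊕ (scale c p) (scale c q) n ⟨
    coeff (scale c p ⊕ scale c q) n            ∎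

  scale-+ : ∀ a b p → scale (a + b) p ≋ scale a p ⊕ scale b p
  scale-+ a b p = pw λ n → begin
    coeff (scale (a + b) p) n                  ≡⟨ coeff-scale (a + b) p n ⟩
    (a + b) * coeff p n                        ≡⟨ R.distribʳ _ a b ⟩
    a * coeff p n + b * coeff p n              ≡⟨ cong₂ _+_ (coeff-scale a p n) (coeff-scale b p n) ⟨
    coeff (scale a p) n + coeff (scale b p) n  ≡⟨ coeff-⊕ (scale a p) (scale b p) n ⟨
    coeff (scale a p ⊕ scale b p) n            ∎

  scale-* : ∀ c d p → scale c (scale d p) ≋ scale (c * d) p
  scale-* c d p = pw λ n → begin
    coeff (scale c (scale d p)) n  ≡⟨ coeff-scale c (scale d p) n ⟩
    c * coeff (scale d p) n        ≡⟨ cong (c *_) (coeff-scale d p n) ⟩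
    c * (d * coeff p n)            ≡⟨ R.*-assoc _ _ _ ⟨
    (c * d) * coeff p n            ≡⟨ coeff-scale (c * d) p n ⟨
    coeff (scale (c * d) p) n      ∎

  scale-comm : ∀ a c q → scale a (scale c q) ≋ scale c (scale a q)
  scale-comm a c q = ≋-trans (scale-* a c q)
    (≋-trans (≡⇒≋ (cong (λ z → scale z q) (R.*-comm a c))) (≋-sym (scale-* c a q)))

  scale-zero : ∀ p → scale 0# p ≋ []
  scale-zero p = pw λ n → trans (coeff-scale 0# p n) (R.zeroˡ _)

  scale-one : ∀ p → scale 1# p ≋ p
  scale-one p = pw λ n → trans (coeff-scale 1# p n) (R.*-identityˡ _)

  shift-⊕ : ∀ p q → 0# ∷ (p ⊕ q) ≋ (0# ∷ p) ⊕ (0# ∷ q)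
  shift-⊕ p q = pw λ { zero → sym (R.+-identityˡ 0#) ; (suc n) → refl }

  ⊛-congʳ : ∀ p {q q′} → q ≋ q′ → p ⊛ q ≋ p ⊛ q′
  ⊛-congʳ []      e = ≋-refl
  ⊛-congʳ (a ∷ p) e = ⊕-cong (scale-cong e) (∷-cong refl (⊛-congʳ p e))

  ⊛-congˡ : ∀ {p p′} q → p ≋ p′ → p ⊛ q ≋ p′ ⊛ q
  ⊛-congˡ {p} {p′} q e = pw λ n → go n p p′ e
    where
    go : ∀ n p p′ → p ≋ p′ → coeff (p ⊛ q) n ≡ coeff (p′ ⊛ q) n
    go zero p p′ e = begin
      coeff (p ⊛ q) 0   ≡⟨ coeff-⊛-zero p q ⟩
      hd p * hd q       ≡⟨ cong (_* hd q) (at e 0) ⟩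
      hd p′ * hd q      ≡⟨ coeff-⊛-zero p′ q ⟨
      coeff (p′ ⊛ q) 0  ∎
    go (suc n) p p′ e = begin
      coeff (p ⊛ q) (suc n)                              ≡⟨ coeff-⊛-suc p q n ⟩
      hd p * coeff q (suc n) + coeff (tl p ⊛ q) n
        ≡⟨ cong₂ _+_ (cong (_* coeff q (suc n)) (at e 0)) (go n (tl p) (tl p′) (tl-cong e)) ⟩
      hd p′ * coeff q (suc n) + coeff (tl p′ ⊛ q) n      ≡⟨ coeff-⊛-suc p′ q n ⟨
      coeff (p′ ⊛ q) (suc n)                             ∎

  ⊛-cong : ∀ {p p′ q q′} → p ≋ p′ → q ≋ q′ → p ⊛ q ≋ p′ ⊛ q′
  ⊛-cong {p} {p′} {q} {q′} e f = ≋-trans (⊛-congˡ q e) (⊛-congʳ p′ f)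

  ⊛-zeroʳ : ∀ p → p ⊛ [] ≋ []
  ⊛-zeroʳ []      = ≋-refl
  ⊛-zeroʳ (a ∷ p) = ≋-trans (∷-cong refl (⊛-zeroʳ p)) zero-constant

  ⊛-distribˡ : ∀ p q r → p ⊛ (q ⊕ r) ≋ (p ⊛ q) ⊕ (p ⊛ r)
  ⊛-distribˡ []      q r = ≋-refl
  ⊛-distribˡ (a ∷ p) q r = ≋-trans
    (⊕-cong (scale-⊕ a q r)
            (≋-trans (∷-cong refl (⊛-distribˡ p q r)) (shift-⊕ (p ⊛ q) (p ⊛ r))))
    (⊕-interchange (scale a q) (scale a r) (0# ∷ (p ⊛ q)) (0# ∷ (p ⊛ r)))

  ⊛-distribʳ : ∀ p q r → (p ⊕ q) ⊛ r ≋ (p ⊛ r) ⊕ (q ⊛ r)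
  ⊛-distribʳ []      q       r = ≋-refl
  ⊛-distribʳ (a ∷ p) []      r = ≋-sym (⊕-identityʳ _)
  ⊛-distribʳ (a ∷ p) (b ∷ q) r = ≋-trans
    (⊕-cong (scale-+ a b r)
            (≋-trans (∷-cong refl (⊛-distribʳ p q r)) (shift-⊕ (p ⊛ r) (q ⊛ r))))
    (⊕-interchange (scale a r) (scale b r) (0# ∷ (p ⊛ r)) (0# ∷ (q ⊛ r)))

  shift-⊛ : ∀ p q → (0# ∷ p) ⊛ q ≋ 0# ∷ (p ⊛ q)
  shift-⊛ p q = ⊕-cong (scale-zero q) ≋-refl

  ⊛-shift : ∀ p q → p ⊛ (0# ∷ q) ≋ 0# ∷ (p ⊛ q)
  ⊛-shift []      q = ≋-sym zero-constant
  ⊛-shift (a ∷ p) q = ≋-trans (⊕-cong (≋-refl {scale a (0# ∷ q)}) (∷-cong refl (⊛-shift p q)))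
    (pw λ { zero → trans (cong (_+ 0#) (R.zeroʳ a)) (R.+-identityʳ 0#) ; (suc n) → refl })

  scale-⊛ : ∀ c p q → scale c p ⊛ q ≋ scale c (p ⊛ q)
  scale-⊛ c []      q = ≋-refl
  scale-⊛ c (a ∷ p) q = ≋-trans
    (⊕-cong (≋-sym (scale-* c a q)) (∷-cong (sym (R.zeroʳ c)) (scale-⊛ c p q)))
    (≋-sym (scale-⊕ c (scale a q) (0# ∷ (p ⊛ q))))

  ⊛-scale : ∀ c p q → p ⊛ scale c q ≋ scale c (p ⊛ q)
  ⊛-scale c []      q = ≋-refl
  ⊛-scale c (a ∷ p) q = ≋-trans
    (⊕-cong (scale-comm a c q) (∷-cong (sym (R.zeroʳ c)) (⊛-scale c p q)))
    (≋-sym (scale-⊕ c (scale a q) (0# ∷ (p ⊛ q))))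

  ⊛-constant : ∀ p b → p ⊛ (b ∷ []) ≋ scale b p
  ⊛-constant []      b = ≋-refl
  ⊛-constant (a ∷ p) b = ≋-trans (⊕-cong (≋-refl {a * b ∷ []}) (∷-cong refl (⊛-constant p b)))
    (pw λ { zero → trans (R.+-identityʳ _) (R.*-comm a b) ; (suc n) → refl })

  ⊛-comm : ∀ p q → p ⊛ q ≋ q ⊛ p
  ⊛-comm []      q = ≋-sym (⊛-zeroʳ q)
  ⊛-comm (a ∷ p) q = ≋-trans
    (⊕-cong (≋-sym (⊛-constant q a))
            (≋-trans (∷-cong refl (⊛-comm p q)) (≋-sym (⊛-shift q p))))
    (≋-trans (≋-sym (⊛-distribˡ q (a ∷ []) (0# ∷ p)))
             (⊛-congʳ q (pw λ { zero → R.+-identityʳ a ; (suc n) → refl })))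

  ⊛-assoc : ∀ p q r → (p ⊛ q) ⊛ r ≋ p ⊛ (q ⊛ r)
  ⊛-assoc []      q r = ≋-refl
  ⊛-assoc (a ∷ p) q r = ≋-trans (⊛-distribʳ (scale a q) (0# ∷ (p ⊛ q)) r)
    (⊕-cong (scale-⊛ a q r) (≋-trans (shift-⊛ (p ⊛ q) r) (∷-cong refl (⊛-assoc p q r))))

  ⊛-identityˡ : ∀ p → 1p ⊛ p ≋ p
  ⊛-identityˡ p = ≋-trans (⊕-cong (scale-one p) zero-constant) (⊕-identityʳ p)

  neg : Pol → Pol
  neg = scale (- 1#)

  ⊕-inverseʳ : ∀ p → p ⊕ neg p ≋ []
  ⊕-inverseʳ p = pw λ n → begin
    coeff (p ⊕ neg p) n                   ≡⟨ coeff-⊕ p (neg p) n ⟩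
    coeff p n + coeff (neg p) n
      ≡⟨ cong₂ _+_ (sym (R.*-identityˡ _)) (coeff-scale (- 1#) p n) ⟩
    1# * coeff p n + (- 1#) * coeff p n   ≡⟨ R.distribʳ _ _ _ ⟨
    (1# + - 1#) * coeff p n               ≡⟨ cong (_* coeff p n) (R.-‿inverseʳ 1#) ⟩
    0# * coeff p n                        ≡⟨ R.zeroˡ _ ⟩
    0#                                    ∎

  _⊖_ : Pol → Pol → Pol
  p ⊖ q = p ⊕ neg q

  polyRing : CommutativeRing 0ℓ 0ℓ
  polyRing = record
    { Carrier = Pol ; _≈_ = _≋_ ; _+_ = _⊕_ ; _*_ = _⊛_ ; -_ = neg ; 0# = [] ; 1# = 1p
    ; isCommutativeRing = record
      { isRing = record
        { +-isAbelianGroup = record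
          { isGroup = record
            { isMonoid = record
              { isSemigroup = record
                { isMagma = record { isEquivalence = ≋-isEquivalence ; ∙-cong = ⊕-cong }
                ; assoc = ⊕-assoc }
              ; identity = (λ p → ≋-refl) , ⊕-identityʳ }
            ; inverse = (λ p → ≋-trans (⊕-comm (neg p) p) (⊕-inverseʳ p)) , ⊕-inverseʳ
            ; ⁻¹-cong = scale-cong }
          ; comm = ⊕-comm }
        ; *-cong = ⊛-cong
        ; *-assoc = ⊛-assoc
        ; *-identity = ⊛-identityˡ , (λ p → ≋-trans (⊛-comm p 1p) (⊛-identityˡ p))
        ; distrib = ⊛-distribˡ , (λ r p q → ⊛-distribʳ p q r) }
      ; *-comm = ⊛-comm }
    }

  ⊖-interchange : ∀ p q r s → (p ⊖ q) ⊕ (r ⊖ s) ≋ (p ⊕ r) ⊖ (q ⊕ s)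
  ⊖-interchange p q r s = ≋-trans (⊕-interchange p (neg q) r (neg s))
                                  (⊕-cong ≋-refl (≋-sym (scale-⊕ (- 1#) q s)))

  open import Algebra.Properties.Ring (CommutativeRing.ring polyRing) public
    using () renaming (x[y-z]≈xy-xz to ⊛-distribˡ-⊖)
  open import Algebra.Properties.Group (CommutativeRing.+-group polyRing) public
    using ()
    renaming (//-rightDividesʳ to ⊕⊖-cancel; x∙y⁻¹≈ε⇒x≈y to ⊖≋[]⇒≋; x≈y⇒x∙y⁻¹≈ε to ≋⇒⊖≋[]; ∙-cancelˡ to ⊕-cancelˡ)
  open import Algebra.Properties.CommutativeSemigroup (CommutativeRing.*-commutativeSemigroup polyRing)
    public using () renaming (x∙yz≈y∙xz to ⊛-left-comm)

module Degrees (𝔽 : FiniteField) where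
  open FiniteField 𝔽
  open Poly 𝔽
  open Arithmetic 𝔽
  open ≡-Reasoning

  coeff-cons⁰ : ∀ x l n → coeff (cons⁰ x l) n ≡ coeff (x ∷ l) n
  coeff-cons⁰ x []      n with x ≟ 0#
  coeff-cons⁰ x []      zero    | yes x≡0 = sym x≡0
  coeff-cons⁰ x []      (suc n) | yes _   = refl
  ... | no _ = refl
  coeff-cons⁰ x (y ∷ l) n = refl

  trim≋ : ∀ p → trim p ≋ p
  trim≋ []      = ≋-refl
  trim≋ (a ∷ p) = ≋-trans (pw (coeff-cons⁰ a (trim p))) (∷-cong refl (trim≋ p))

  ≋[]⇒trim≡[] : ∀ p → p ≋ [] → trim p ≡ []
  ≋[]⇒trim≡[] []      e = refl
  ≋[]⇒trim≡[] (a ∷ p) e rewrite ≋[]⇒trim≡[] p (tl-cong e) with a ≟ 0#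
  ... | yes _   = refl
  ... | no a≢0 = ⊥-elim (a≢0 (at e 0))

  ≋⇒≈ : ∀ {p q} → p ≋ q → p ≈ q
  ≋⇒≈ {[]}    {q}     e = sym (≋[]⇒trim≡[] q (≋-sym e))
  ≋⇒≈ {a ∷ p} {[]}    e = ≋[]⇒trim≡[] (a ∷ p) e
  ≋⇒≈ {a ∷ p} {b ∷ q} e with at e 0
  ... | refl = cong (cons⁰ a) (≋⇒≈ {p} {q} (tl-cong e))

  ≈⇒≋ : ∀ {p q} → p ≈ q → p ≋ q
  ≈⇒≋ {p} {q} e = ≋-trans (≋-sym (trim≋ p)) (≋-trans (≡⇒≋ e) (trim≋ q))

  IsZero-cong : ∀ {p q} → p ≋ q → IsZero p → IsZero q
  IsZero-cong {p} {q} e z = ≋⇒≈ (≋-trans (≋-sym e) (≈⇒≋ {p} {[]} z))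

  ≋[]? : ∀ p → Dec (p ≋ [])
  ≋[]? p with trim p in eq
  ... | []    = yes (≈⇒≋ {p} {[]} eq)
  ... | _ ∷ _ = no λ z → case trans (sym eq) (≋[]⇒trim≡[] p z) of λ ()

  deg-cong : ∀ {p q} → p ≋ q → deg p ≡ deg q
  deg-cong e = cong deg′ (≋⇒≈ e)

  DegreeBelow : ℕ → Pol → Set
  DegreeBelow d p = ∀ n → d ≤ n → coeff p n ≡ 0#

  DegreeBelow-length : ∀ l → DegreeBelow (length l) l
  DegreeBelow-length []      n       _         = refl
  DegreeBelow-length (a ∷ l) (suc n) (s≤s le) = DegreeBelow-length l n le

  DegreeBelow-vec : ∀ {n} (v : Vec F n) → DegreeBelow n (toList v)
  DegreeBelow-vec {n} v =
    subst (λ k → DegreeBelow k (toList v)) (length-toList v) (DegreeBelow-length (toList v))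

  DegreeBelow-mono : ∀ {d d′} p → d ≤ d′ → DegreeBelow d p → DegreeBelow d′ p
  DegreeBelow-mono p le b n le′ = b n (≤-trans le le′)

  DegreeBelow-cong : ∀ {d p q} → p ≋ q → DegreeBelow d p → DegreeBelow d q
  DegreeBelow-cong e b n le = trans (sym (at e n)) (b n le)

  DegreeBelow-scale : ∀ {d} c p → DegreeBelow d p → DegreeBelow d (scale c p)
  DegreeBelow-scale c p b n le =
    trans (coeff-scale c p n) (trans (cong (c *_) (b n le)) (R.zeroʳ c))

  DegreeBelow-⊕ : ∀ {d} p q → DegreeBelow d p → DegreeBelow d q → DegreeBelow d (p ⊕ q)
  DegreeBelow-⊕ p q b c n le =
    trans (coeff-⊕ p q n) (trans (cong₂ _+_ (b n le) (c n le)) (R.+-identityʳ 0#))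

  record HasDegree (p : Pol) (d : ℕ) : Set where
    constructor hasDegree
    field
      lead≢0 : coeff p d ≢ 0#
      below  : DegreeBelow (suc d) p

  trim-last≢0 : ∀ p x xs → trim p ≡ x ∷ xs → coeff (x ∷ xs) (length xs) ≢ 0#
  trim-last≢0 []      x xs ()
  trim-last≢0 (a ∷ p) x xs eq with trim p in eq′
  trim-last≢0 (a ∷ p) x xs eq | [] with a ≟ 0#
  trim-last≢0 (a ∷ p) x xs () | [] | yes _
  trim-last≢0 (a ∷ p) .a .[] refl | [] | no a≢0 = a≢0
  trim-last≢0 (a ∷ p) .a .(y ∷ ys) refl | y ∷ ys = trim-last≢0 p y ys eq′

  DegreeBelow-deg : ∀ p → DegreeBelow (suc (deg p)) p
  DegreeBelow-deg p n le with trim p in eq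
  ... | []     = trans (sym (at (trim≋ p) n)) (cong (λ l → coeff l n) eq)
  ... | x ∷ xs = trans (sym (at (trim≋ p) n))
                   (trans (cong (λ l → coeff l n) eq) (DegreeBelow-length (x ∷ xs) n le))

  HasDegree-deg : ∀ p → ¬ (p ≋ []) → HasDegree p (deg p)
  HasDegree-deg p p≢0 with trim p in eq
  ... | []     = ⊥-elim (p≢0 (≈⇒≋ {p} {[]} eq))
  ... | x ∷ xs = hasDegree lead≢0 (subst (λ l → DegreeBelow (suc (deg′ l)) p) eq (DegreeBelow-deg p))
    where
    lead≢0 : coeff p (length xs) ≢ 0#
    lead≢0 z = trim-last≢0 p x xs eq
      (trans (cong (λ l → coeff l (length xs)) (sym eq)) (trans (at (trim≋ p) (length xs)) z))

  HasDegree⇒≢0 : ∀ {p d} → HasDegree p d → ¬ (p ≋ [])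
  HasDegree⇒≢0 (hasDegree lead≢0 _) z = lead≢0 (at z _)

  HasDegree-unique : ∀ {p d d′} → HasDegree p d → HasDegree p d′ → d ≡ d′
  HasDegree-unique {p} {d} {d′} (hasDegree lead≢0 b) (hasDegree lead≢0′ b′) with <-cmp d d′
  ... | tri< d<d′ _ _ = ⊥-elim (lead≢0′ (b d′ d<d′))
  ... | tri≈ _ d≡d′ _ = d≡d′
  ... | tri> _ _ d>d′ = ⊥-elim (lead≢0 (b′ d d>d′))

  deg-HasDegree : ∀ {p d} → HasDegree p d → deg p ≡ d
  deg-HasDegree {p} D = HasDegree-unique (HasDegree-deg p (HasDegree⇒≢0 D)) D

  DegreeBelow-⊛ : ∀ a {b} p q → DegreeBelow (suc a) p → DegreeBelow (suc b) q →
    DegreeBelow (suc (a +ₙ b)) (p ⊛ q) × (coeff (p ⊛ q) (a +ₙ b) ≡ coeff p a * coeff q b)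
  DegreeBelow-⊛ zero {b} p q bp bq = bound , top b
    where
    tl≋[] : tl p ≋ []
    tl≋[] = pw λ n → trans (coeff-tl p n) (bp (suc n) (s≤s z≤n))
    tl-term : ∀ n → coeff (tl p ⊛ q) n ≡ 0#
    tl-term = at (⊛-congˡ q tl≋[])
    bound : DegreeBelow (suc b) (p ⊛ q)
    bound (suc n) le = begin
      coeff (p ⊛ q) (suc n)                         ≡⟨ coeff-⊛-suc p q n ⟩
      hd p * coeff q (suc n) + coeff (tl p ⊛ q) n   ≡⟨ cong₂ _+_ (cong (hd p *_) (bq (suc n) le)) (tl-term n) ⟩
      hd p * 0# + 0#                                ≡⟨ trans (R.+-identityʳ _) (R.zeroʳ _) ⟩
      0#                                            ∎
    top : ∀ b → coeff (p ⊛ q) b ≡ coeff p 0 * coeff q b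
    top zero    = coeff-⊛-zero p q
    top (suc b) = trans (coeff-⊛-suc p q b)
      (trans (cong (hd p * coeff q (suc b) +_) (tl-term b)) (R.+-identityʳ _))
  DegreeBelow-⊛ (suc a) {b} p q bp bq = bound , top
    where
    btl : DegreeBelow (suc a) (tl p)
    btl n le = trans (coeff-tl p n) (bp (suc n) (s≤s le))
    IH = DegreeBelow-⊛ a (tl p) q btl bq
    bound : DegreeBelow (suc (suc (a +ₙ b))) (p ⊛ q)
    bound (suc n) (s≤s le) = begin
      coeff (p ⊛ q) (suc n)                         ≡⟨ coeff-⊛-suc p q n ⟩
      hd p * coeff q (suc n) + coeff (tl p ⊛ q) n
        ≡⟨ cong₂ _+_ (cong (hd p *_) (bq (suc n) (s≤s (≤-trans (m≤n+m b a) (≤-trans (n≤1+n _) le)))))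
                     (proj₁ IH n le) ⟩
      hd p * 0# + 0#                                ≡⟨ trans (R.+-identityʳ _) (R.zeroʳ _) ⟩
      0#                                            ∎
    top : coeff (p ⊛ q) (suc (a +ₙ b)) ≡ coeff p (suc a) * coeff q b
    top = begin
      coeff (p ⊛ q) (suc (a +ₙ b))                             ≡⟨ coeff-⊛-suc p q (a +ₙ b) ⟩
      hd p * coeff q (suc (a +ₙ b)) + coeff (tl p ⊛ q) (a +ₙ b)
        ≡⟨ cong₂ _+_ (cong (hd p *_) (bq (suc (a +ₙ b)) (s≤s (m≤n+m b a)))) (proj₂ IH) ⟩
      hd p * 0# + coeff (tl p) a * coeff q b
        ≡⟨ trans (cong (_+ coeff (tl p) a * coeff q b) (R.zeroʳ _)) (R.+-identityˡ _) ⟩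
      coeff (tl p) a * coeff q b                               ≡⟨ cong (_* coeff q b) (coeff-tl p a) ⟩
      coeff p (suc a) * coeff q b                              ∎

  -- Degrees add under multiplication (the field has no zero divisors).
  HasDegree-⊛ : ∀ {p q a b} → HasDegree p a → HasDegree q b → HasDegree (p ⊛ q) (a +ₙ b)
  HasDegree-⊛ {p} {q} {a} {b} (hasDegree p≢0 bp) (hasDegree q≢0 bq) =
    hasDegree (λ z → *-nonzero p≢0 q≢0 (trans (sym (proj₂ B)) z)) (proj₁ B)
    where B = DegreeBelow-⊛ a p q bp bq

  ⊛-≢0 : ∀ {p q} → ¬ (p ≋ []) → ¬ (q ≋ []) → ¬ (p ⊛ q ≋ [])
  ⊛-≢0 {p} {q} p≢0 q≢0 =
    HasDegree⇒≢0 (HasDegree-⊛ (HasDegree-deg p p≢0) (HasDegree-deg q q≢0))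

  deg-⊛ : ∀ {p q} → ¬ (p ≋ []) → ¬ (q ≋ []) → deg (p ⊛ q) ≡ deg p +ₙ deg q
  deg-⊛ {p} {q} p≢0 q≢0 =
    deg-HasDegree (HasDegree-⊛ (HasDegree-deg p p≢0) (HasDegree-deg q q≢0))

  deg-1p : deg 1p ≡ 0
  deg-1p = deg-HasDegree {1p} (hasDegree (λ z → 0≢1 (sym z)) (DegreeBelow-length 1p))

  pow : Pol → ℕ → Pol
  pow A zero    = 1p
  pow A (suc m) = A ⊛ pow A m

  1p≢0 : ¬ (1p ≋ [])
  1p≢0 z = 0≢1 (sym (at z 0))

  pow-≢0 : ∀ {A} → ¬ (A ≋ []) → ∀ m → ¬ (pow A m ≋ [])
  pow-≢0 A≢0 zero    = 1p≢0
  pow-≢0 A≢0 (suc m) = ⊛-≢0 A≢0 (pow-≢0 A≢0 m)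

  ⊛-cancelˡ : ∀ {c a b} → ¬ (c ≋ []) → c ⊛ a ≋ c ⊛ b → a ≋ b
  ⊛-cancelˡ {c} {a} {b} c≢0 e with ≋[]? (a ⊖ b)
  ... | yes a-b≋0 = ⊖≋[]⇒≋ a b a-b≋0
  ... | no  a-b≢0 = ⊥-elim (⊛-≢0 c≢0 a-b≢0 (≋-trans (⊛-distribˡ-⊖ c a b) (≋⇒⊖≋[] e)))

  -- If P q + r = 0 with deg r < deg P, then q = 0: otherwise the
  -- coefficient of P q in degree deg P + deg q would be both 0 and nonzero.
  quotient-vanishes : ∀ {P d} → HasDegree P d → ∀ q r → DegreeBelow d r →
                      (P ⊛ q) ⊕ r ≋ [] → q ≋ []
  quotient-vanishes {P} {d} P-deg q r r<d e with ≋[]? q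
  ... | yes q≋0 = q≋0
  ... | no  q≢0 = ⊥-elim (HasDegree.lead≢0 Pq-deg (begin
        coeff (P ⊛ q) top                   ≡⟨ R.+-identityʳ _ ⟨
        coeff (P ⊛ q) top + 0#              ≡⟨ cong (coeff (P ⊛ q) top +_) (r<d top (m≤m+n d _)) ⟨
        coeff (P ⊛ q) top + coeff r top     ≡⟨ coeff-⊕ (P ⊛ q) r top ⟨
        coeff ((P ⊛ q) ⊕ r) top             ≡⟨ at e top ⟩
        0#                                  ∎))
    where
    top = d +ₙ deg q
    Pq-deg = HasDegree-⊛ P-deg (HasDegree-deg q q≢0)

module Division (𝔽 : FiniteField) where
  open FiniteField 𝔽
  open Poly 𝔽
  open Arithmetic 𝔽
  open Degrees 𝔽

  quot : Pol → Pol → Pol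
  quot P A = proj₁ (divMod P A)

  rem : (P : Pol) → Pol → Digit P
  rem P A = proj₂ (divMod P A)

  lastV-coeff : ∀ {n} (v : Vec F (suc n)) → lastV v ≡ coeff (toList v) n
  lastV-coeff (x ∷ [])     = refl
  lastV-coeff (x ∷ y ∷ ys) = lastV-coeff (y ∷ ys)

  initV-coeff : ∀ {n} (v : Vec F (suc n)) → lastV v ≡ 0# → toList (initV v) ≋ toList v
  initV-coeff (x ∷ [])     e = pw λ { zero → sym e ; (suc n) → refl }
  initV-coeff (x ∷ y ∷ ys) e = ∷-cong refl (initV-coeff (y ∷ ys) e)

  coeff-zipWith : ∀ {n} (f : F → F → F) → f 0# 0# ≡ 0# → (u v : Vec F n) → ∀ i →
    coeff (toList (zipWith f u v)) i ≡ f (coeff (toList u) i) (coeff (toList v) i)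
  coeff-zipWith f f0 []      []      i       = sym f0
  coeff-zipWith f f0 (x ∷ u) (y ∷ v) zero    = refl
  coeff-zipWith f f0 (x ∷ u) (y ∷ v) (suc i) = coeff-zipWith f f0 u v i

  divStep-correct : ∀ {n} (Pv : Vec F (suc n)) → lastV Pv ≢ 0# → (r : Vec F n) (a : F) →
    a ∷ toList r ≋ scale (proj₁ (divStep Pv r a)) (toList Pv) ⊕ toList (proj₂ (divStep Pv r a))
  divStep-correct {n} Pv lead≢0 r a =
    ≋-trans (pw sh≡) (⊕-cong ≋-refl (≋-sym (initV-coeff new top≡0)))
    where
    open ≡-Reasoning
    sh = a ∷ r
    c  = lastV sh * (lastV Pv ⁻¹)
    f : F → F → F
    f x p = x + - (c * p)
    f0 : f 0# 0# ≡ 0#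
    f0 = begin
      0# + - (c * 0#)  ≡⟨ cong (λ z → 0# + - z) (R.zeroʳ c) ⟩
      0# + - 0#        ≡⟨ R.-‿inverseʳ 0# ⟩
      0#               ∎
    new = zipWith f sh Pv
    top≡0 : lastV new ≡ 0#
    top≡0 = begin
      lastV new                                  ≡⟨ lastV-coeff new ⟩
      coeff (toList new) n                       ≡⟨ coeff-zipWith f f0 sh Pv n ⟩
      f (coeff (toList sh) n) (coeff (toList Pv) n)
        ≡⟨ cong₂ f (sym (lastV-coeff sh)) (sym (lastV-coeff Pv)) ⟩
      lastV sh + - (c * lastV Pv)                ≡⟨ cong (λ z → lastV sh + - z) (R.*-assoc _ _ _) ⟩
      lastV sh + - (lastV sh * (lastV Pv ⁻¹ * lastV Pv))
        ≡⟨ cong (λ z → lastV sh + - (lastV sh * z)) (trans (R.*-comm _ _) (⁻¹-inverse _ lead≢0)) ⟩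
      lastV sh + - (lastV sh * 1#)               ≡⟨ cong (λ z → lastV sh + - z) (R.*-identityʳ _) ⟩
      lastV sh + - lastV sh                      ≡⟨ R.-‿inverseʳ _ ⟩
      0#                                         ∎
    sh≡ : ∀ i → coeff (toList sh) i ≡ coeff (scale c (toList Pv) ⊕ toList new) i
    sh≡ i = sym (begin
      coeff (scale c (toList Pv) ⊕ toList new) i
        ≡⟨ coeff-⊕ (scale c (toList Pv)) (toList new) i ⟩
      coeff (scale c (toList Pv)) i + coeff (toList new) i
        ≡⟨ cong₂ _+_ (coeff-scale c (toList Pv) i) (coeff-zipWith f f0 sh Pv i) ⟩
      c * coeff (toList Pv) i + (coeff (toList sh) i + - (c * coeff (toList Pv) i))
        ≡⟨ y+[x-y]≡x _ _ ⟩
      coeff (toList sh) i ∎)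

  -- reverseAcc u as  is the polynomial with low coefficients  as  (listed
  -- from the top) and high part  u.
  reverseAcc-cong : ∀ {u u′} as → u ≋ u′ → reverseAcc u as ≋ reverseAcc u′ as
  reverseAcc-cong []       e = e
  reverseAcc-cong (a ∷ as) e = reverseAcc-cong as (∷-cong refl e)

  -- Invariant of the division loop: the part of A already read equals
  -- P · acc + r, where acc holds the quotient digits found so far.
  divLoop-correct : ∀ {n} (Pv : Vec F (suc n)) → lastV Pv ≢ 0# → ∀ as acc (r : Vec F n) →
    reverseAcc (toList r ⊕ (toList Pv ⊛ acc)) as ≋
      (toList Pv ⊛ proj₁ (divLoop Pv as acc r)) ⊕ toList (proj₂ (divLoop Pv as acc r))
  divLoop-correct Pv lead≢0 []       acc r = ⊕-comm (toList r) (toList Pv ⊛ acc)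
  divLoop-correct Pv lead≢0 (a ∷ as) acc r =
    ≋-trans (reverseAcc-cong as shifted) (divLoop-correct Pv lead≢0 as (c ∷ acc) r′)
    where
    open ≋-Reasoning
    P′ = toList Pv
    c  = proj₁ (divStep Pv r a)
    r′ = proj₂ (divStep Pv r a)
    shifted : a ∷ (toList r ⊕ (P′ ⊛ acc)) ≋ toList r′ ⊕ (P′ ⊛ (c ∷ acc))
    shifted = begin
      a ∷ (toList r ⊕ (P′ ⊛ acc))              ≈⟨ ∷-cong (sym (R.+-identityʳ a)) ≋-refl ⟩
      (a ∷ toList r) ⊕ (0# ∷ (P′ ⊛ acc))       ≈⟨ ⊕-cong (divStep-correct Pv lead≢0 r a) ≋-refl ⟩
      (scale c P′ ⊕ toList r′) ⊕ (0# ∷ (P′ ⊛ acc))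
        ≈⟨ ⊕-cong (⊕-comm (scale c P′) (toList r′)) ≋-refl ⟩
      (toList r′ ⊕ scale c P′) ⊕ (0# ∷ (P′ ⊛ acc))
        ≈⟨ ⊕-assoc (toList r′) (scale c P′) (0# ∷ (P′ ⊛ acc)) ⟩
      toList r′ ⊕ (scale c P′ ⊕ (0# ∷ (P′ ⊛ acc)))
        ≈⟨ ⊕-cong (≋-refl {toList r′}) (⊕-cong (≋-refl {scale c P′}) (∷-cong refl (⊛-comm P′ acc))) ⟩
      toList r′ ⊕ ((c ∷ acc) ⊛ P′)             ≈⟨ ⊕-cong ≋-refl (⊛-comm (c ∷ acc) P′) ⟩
      toList r′ ⊕ (P′ ⊛ (c ∷ acc))             ∎

  replicate-zero : ∀ n → toList (replicate n 0#) ≋ []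
  replicate-zero zero    = ≋-refl
  replicate-zero (suc n) = ≋-trans (∷-cong refl (replicate-zero n)) zero-constant

  divMod-correct : ∀ P A → ¬ (P ≋ []) → A ≋ (P ⊛ quot P A) ⊕ toList (rem P A)
  divMod-correct P A P≢0 with trim P in eq
  ... | []     = ⊥-elim (P≢0 (≈⇒≋ {P} {[]} eq))
  ... | p ∷ ps = begin
      A                                                    ≡⟨ reverse-involutive A ⟨
      reverseAcc [] (reverse A)
        ≈⟨ reverseAcc-cong (reverse A) (≋-sym start≋[]) ⟩
      reverseAcc (toList (replicate _ 0#) ⊕ (toList Pv ⊛ [])) (reverse A)
        ≈⟨ divLoop-correct Pv lead≢0 (reverse A) [] (replicate _ 0#) ⟩
      (toList Pv ⊛ q) ⊕ toList r
        ≈⟨ ⊕-cong (⊛-congˡ q (≋-trans (≡⇒≋ (toList∘fromList (p ∷ ps)))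
                                      (≋-trans (≡⇒≋ (sym eq)) (trim≋ P)))) ≋-refl ⟩
      (P ⊛ q) ⊕ toList r                                   ∎
    where
    open ≋-Reasoning
    Pv = fromList (p ∷ ps)
    q  = proj₁ (divModL (p ∷ ps) A)
    r  = proj₂ (divModL (p ∷ ps) A)
    lead≢0 : lastV Pv ≢ 0#
    lead≢0 z = trim-last≢0 P p ps eq
      (trans (cong (λ l → coeff l (length ps)) (sym (toList∘fromList (p ∷ ps))))
             (trans (sym (lastV-coeff Pv)) z))
    start≋[] : toList (replicate (length ps) 0#) ⊕ (toList Pv ⊛ []) ≋ []
    start≋[] = ⊕-cong (replicate-zero _) (⊛-zeroʳ (toList Pv))

  ≋⇒vec≡ : ∀ {n} (u v : Vec F n) → toList u ≋ toList v → u ≡ v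
  ≋⇒vec≡ []      []      e = refl
  ≋⇒vec≡ (x ∷ u) (y ∷ v) e = cong₂ _∷_ (at e 0) (≋⇒vec≡ u v (tl-cong e))

  divMod-unique : ∀ P A q (s : Digit P) → ¬ (P ≋ []) → A ≋ (P ⊛ q) ⊕ toList s →
                  (quot P A ≋ q) × (rem P A ≡ s)
  divMod-unique P A q s P≢0 A≋ = q′≋q , ≋⇒vec≡ r′ s r′≋s
    where
    q′ = quot P A
    r′ = rem P A
    same : (P ⊛ q′) ⊕ toList r′ ≋ (P ⊛ q) ⊕ toList s
    same = ≋-trans (≋-sym (divMod-correct P A P≢0)) A≋
    difference : (P ⊛ (q′ ⊖ q)) ⊕ (toList r′ ⊖ toList s) ≋ []
    difference = ≋-trans (⊕-cong (⊛-distribˡ-⊖ P q′ q) ≋-refl)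
      (≋-trans (⊖-interchange (P ⊛ q′) (P ⊛ q) (toList r′) (toList s)) (≋⇒⊖≋[] same))
    r′-s<deg : DegreeBelow (deg P) (toList r′ ⊖ toList s)
    r′-s<deg = DegreeBelow-⊕ (toList r′) (neg (toList s)) (DegreeBelow-vec r′)
                 (DegreeBelow-scale (- 1#) (toList s) (DegreeBelow-vec s))
    q′≋q : q′ ≋ q
    q′≋q = ⊖≋[]⇒≋ q′ q
      (quotient-vanishes (HasDegree-deg P P≢0) (q′ ⊖ q) _ r′-s<deg difference)
    r′≋s : toList r′ ≋ toList s
    r′≋s = ⊕-cancelˡ (P ⊛ q) (toList r′) (toList s)
      (≋-trans (⊕-cong (⊛-congʳ P (≋-sym q′≋q)) ≋-refl) same)

  divMod-cong : ∀ P {A A′} → ¬ (P ≋ []) → A ≋ A′ →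
                (quot P A ≋ quot P A′) × (rem P A ≡ rem P A′)
  divMod-cong P {A} {A′} P≢0 e =
    divMod-unique P A (quot P A′) (rem P A′) P≢0 (≋-trans e (divMod-correct P A′ P≢0))

  toVec : (n : ℕ) → Pol → Vec F n
  toVec zero    p = []
  toVec (suc n) p = hd p ∷ toVec n (tl p)

  toVec-correct : ∀ n p → DegreeBelow n p → toList (toVec n p) ≋ p
  toVec-correct zero    p b = pw λ i → sym (b i z≤n)
  toVec-correct (suc n) p b =
    ≋-trans (∷-cong refl (toVec-correct n (tl p) (λ i le → trans (coeff-tl p i) (b (suc i) (s≤s le)))))
            (hd-tl p)

  quot-small : ∀ P A → ¬ (P ≋ []) → DegreeBelow (deg P) A → quot P A ≋ []
  quot-small P A P≢0 b = proj₁ (divMod-unique P A [] (toVec (deg P) A) P≢0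
    (≋-sym (≋-trans (⊕-cong (⊛-zeroʳ P) ≋-refl) (toVec-correct (deg P) A b))))

module Divisibility (𝔽 : FiniteField) where
  open FiniteField 𝔽
  open Poly 𝔽
  open Arithmetic 𝔽
  open Degrees 𝔽
  open Division 𝔽

  infix 4 _divides_
  _divides_ : Pol → Pol → Set
  g divides x = Σ Pol λ c → c ⊛ g ≋ x

  divides⇒∣ : ∀ {g x} → g divides x → g ∣ x
  divides⇒∣ (c , e) = c , ≋⇒≈ e

  ∣⇒divides : ∀ {g x} → g ∣ x → g divides x
  ∣⇒divides (c , e) = c , ≈⇒≋ e

  divides-cong : ∀ {g x y} → x ≋ y → g divides x → g divides y
  divides-cong e (c , d) = c , ≋-trans d e

  divides-refl : ∀ g → g divides g
  divides-refl g = 1p , ⊛-identityˡ g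

  divides-neg : ∀ {g x} → g divides x → g divides neg x
  divides-neg {g} (c , e) = neg c , ≋-trans (scale-⊛ (- 1#) c g) (scale-cong e)

  divides-⊕ : ∀ {g x y} → g divides x → g divides y → g divides (x ⊕ y)
  divides-⊕ {g} (c , d) (c′ , d′) = c ⊕ c′ , ≋-trans (⊛-distribʳ c c′ g) (⊕-cong d d′)

  divides-⊛ˡ : ∀ {g x} q → g divides x → g divides (q ⊛ x)
  divides-⊛ˡ {g} q (c , d) = q ⊛ c , ≋-trans (⊛-assoc q c g) (⊛-congʳ q d)

  divides-⊛ʳ : ∀ {g x} q → g divides x → g divides (x ⊛ q)
  divides-⊛ʳ {g} {x} q dv = divides-cong (⊛-comm q x) (divides-⊛ˡ q dv)

  divides⇒deg≤ : ∀ {g e} → ¬ (e ≋ []) → g divides e → deg g ≤ deg e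
  divides⇒deg≤ {g} {e} e≢0 (c , ce) =
    subst (deg g ≤_) (trans (sym (deg-⊛ c≢0 g≢0)) (deg-cong ce)) (m≤n+m (deg g) (deg c))
    where
    c≢0 : ¬ (c ≋ [])
    c≢0 z = e≢0 (≋-trans (≋-sym ce) (⊛-congˡ g z))
    g≢0 : ¬ (g ≋ [])
    g≢0 z = e≢0 (≋-trans (≋-sym ce) (≋-trans (⊛-congʳ c z) (⊛-zeroʳ c)))

  LinComb : Pol → Pol → Pol → Set
  LinComb A B g = Σ Pol λ a → Σ Pol λ b → (a ⊛ A) ⊕ (b ⊛ B) ≋ g

  LinComb-cong : ∀ {A B g g′} → g ≋ g′ → LinComb A B g → LinComb A B g′
  LinComb-cong e (a , b , d) = a , b , ≋-trans d e

  LinComb-⊕ : ∀ {A B g g′} → LinComb A B g → LinComb A B g′ → LinComb A B (g ⊕ g′)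
  LinComb-⊕ {A} {B} (a , b , d) (a′ , b′ , d′) = a ⊕ a′ , b ⊕ b′ ,
    ≋-trans (⊕-cong (⊛-distribʳ a a′ A) (⊛-distribʳ b b′ B))
            (≋-trans (⊕-interchange (a ⊛ A) (a′ ⊛ A) (b ⊛ B) (b′ ⊛ B)) (⊕-cong d d′))

  LinComb-⊛ : ∀ {A B g} c → LinComb A B g → LinComb A B (c ⊛ g)
  LinComb-⊛ {A} {B} c (a , b , d) = c ⊛ a , c ⊛ b ,
    ≋-trans (⊕-cong (⊛-assoc c a A) (⊛-assoc c b B))
            (≋-trans (≋-sym (⊛-distribˡ c (a ⊛ A) (b ⊛ B))) (⊛-congʳ c d))

  length-trim : ∀ l → length (trim l) ≤ length l
  length-trim []      = z≤n
  length-trim (a ∷ l) = ≤-trans (length-cons⁰ a (trim l)) (s≤s (length-trim l))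
    where
    length-cons⁰ : ∀ x l → length (cons⁰ x l) ≤ suc (length l)
    length-cons⁰ x []      with x ≟ 0#
    ... | yes _ = z≤n
    ... | no  _ = s≤s z≤n
    length-cons⁰ x (y ∷ l) = ≤-refl

  length-trim-≢0 : ∀ B → ¬ (B ≋ []) → length (trim B) ≡ suc (deg B)
  length-trim-≢0 B B≢0 with trim B in eq
  ... | []    = ⊥-elim (B≢0 (≈⇒≋ {B} {[]} eq))
  ... | _ ∷ _ = refl

  -- The Euclidean algorithm: a common divisor of A and B which is an
  -- A,B-linear combination.  The argument n bounds the size of B.
  euclid-algorithm : ∀ n A B → length (trim B) < n →
    Σ Pol λ g → g divides A × g divides B × LinComb A B g
  euclid-algorithm (suc n) A B B<n with ≋[]? B
  ... | yes B≋0 = A , divides-refl A , ([] , ≋-sym B≋0) ,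
                  (1p , [] , ≋-trans (⊕-identityʳ (1p ⊛ A)) (⊛-identityˡ A))
  ... | no  B≢0 = g , g∣A , g∣B , LinComb-cong g≋ (LinComb-⊕ (LinComb-⊛ b B-comb) (LinComb-⊛ r r-comb))
    where
    q  = quot B A
    rv = rem B A
    A≋ : A ≋ (B ⊛ q) ⊕ toList rv
    A≋ = divMod-correct B A B≢0
    rv<n : length (trim (toList rv)) < n
    rv<n = ≤-<-trans (length-trim (toList rv))
             (subst (_< n) (sym (length-toList rv))
               (subst (_≤ n) (length-trim-≢0 B B≢0) (≤-pred B<n)))
    recursive = euclid-algorithm n B (toList rv) rv<n
    g = proj₁ recursive
    g∣B = proj₁ (proj₂ recursive)
    g∣r = proj₁ (proj₂ (proj₂ recursive))
    b = proj₁ (proj₂ (proj₂ (proj₂ recursive)))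
    r = proj₁ (proj₂ (proj₂ (proj₂ (proj₂ recursive))))
    g≋ = proj₂ (proj₂ (proj₂ (proj₂ (proj₂ recursive))))
    g∣A : g divides A
    g∣A = divides-cong (≋-sym A≋) (divides-⊕ (divides-⊛ʳ q g∣B) g∣r)
    B-comb : LinComb A B B
    B-comb = [] , 1p , ⊛-identityˡ B
    r-comb : LinComb A B (toList rv)
    r-comb = 1p , neg q ,
      ≋-trans (⊕-cong (⊛-identityˡ A) (≋-trans (scale-⊛ (- 1#) q B) (scale-cong (⊛-comm q B))))
              (≋-trans (⊕-cong (≋-trans A≋ (⊕-comm (B ⊛ q) (toList rv))) ≋-refl)
                       (⊕⊖-cancel (B ⊛ q) (toList rv)))

  bezout : ∀ {A B} → Coprime A B → LinComb A B 1p
  bezout {A} {B} cop with euclid-algorithm (suc (length (trim B))) A B (n<1+n _)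
  ... | g , g∣A , g∣B , comb with ∣⇒divides (cop g (divides⇒∣ g∣A) (divides⇒∣ g∣B))
  ... | c , cg≋1 = LinComb-cong cg≋1 (LinComb-⊛ c comb)

  coprime-divides : ∀ {A B y} → Coprime A B → B divides (A ⊛ y) → B divides y
  coprime-divides {A} {B} {y} cop B∣Ay with bezout cop
  ... | a , b , comb = divides-cong y≋ (divides-⊕ (divides-cong (≋-sym (⊛-assoc a A y)) (divides-⊛ˡ a B∣Ay))
                                                  (divides-⊛ʳ y (b , ≋-refl)))
    where
    y≋ : ((a ⊛ A) ⊛ y) ⊕ ((b ⊛ B) ⊛ y) ≋ y
    y≋ = ≋-trans (≋-sym (⊛-distribʳ (a ⊛ A) (b ⊛ B) y))
                 (≋-trans (⊛-congˡ y comb) (⊛-identityˡ y))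

  coprime-divides-pow : ∀ {A B} → Coprime A B → ∀ j {y} → B divides (pow A j ⊛ y) → B divides y
  coprime-divides-pow cop zero    B∣y = divides-cong (⊛-identityˡ _) B∣y
  coprime-divides-pow {A} {B} cop (suc j) {y} B∣AAʲy =
    coprime-divides-pow {A} {B} cop j
      (coprime-divides {A} {B} cop (divides-cong (⊛-assoc A (pow A j) y) B∣AAʲy))

  coprime-powers : ∀ {A B} → Coprime A B → ¬ (B ≋ []) → ∀ k j y z →
                   pow B k ⊛ z ≋ pow A j ⊛ y → pow B k divides y
  coprime-powers cop B≢0 zero j y z e = y , ≋-trans (⊛-comm y 1p) (⊛-identityˡ y)
  coprime-powers {A} {B} cop B≢0 (suc k) j y z e with
    coprime-divides-pow {A} {B} cop j (pow B k ⊛ z , ≋-trans (⊛-comm _ B) (≋-trans (≋-sym (⊛-assoc B (pow B k) z)) e))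
  ... | y′ , y′B≋y = c , (begin
      c ⊛ (B ⊛ pow B k)   ≈⟨ ⊛-congʳ c (⊛-comm B (pow B k)) ⟩
      c ⊛ (pow B k ⊛ B)   ≈⟨ ⊛-assoc c (pow B k) B ⟨
      (c ⊛ pow B k) ⊛ B   ≈⟨ ⊛-congˡ B cBᵏ≋y′ ⟩
      y′ ⊛ B              ≈⟨ y′B≋y ⟩
      y                   ∎)
    where
    open ≋-Reasoning
    reduced : B ⊛ (pow B k ⊛ z) ≋ B ⊛ (pow A j ⊛ y′)
    reduced = begin
      B ⊛ (pow B k ⊛ z)     ≈⟨ ⊛-assoc B (pow B k) z ⟨
      pow B (suc k) ⊛ z     ≈⟨ e ⟩
      pow A j ⊛ y           ≈⟨ ⊛-congʳ (pow A j) (≋-trans (≋-sym y′B≋y) (⊛-comm y′ B)) ⟩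
      pow A j ⊛ (B ⊛ y′)    ≈⟨ ⊛-left-comm (pow A j) B y′ ⟩
      B ⊛ (pow A j ⊛ y′)    ∎
    IH = coprime-powers {A} {B} cop B≢0 k j y′ z (⊛-cancelˡ B≢0 reduced)
    c = proj₁ IH
    cBᵏ≋y′ = proj₂ IH

-- Reading a digit string
-- from the most significant end, the digit s leads from y to y′ when
-- Q y′ = P y + s; the expansion ⟨w⟩ = s_k ⋯ s_0 reads from w_k to w_0 = w.
module DigitExpansions (𝔽 : FiniteField) (P Q : Poly.Pol 𝔽)
    (P≢0 : ¬ Arithmetic._≋_ 𝔽 P []) (Q≢0 : ¬ Arithmetic._≋_ 𝔽 Q []) where
  open FiniteField 𝔽
  open Poly 𝔽
  open Arithmetic 𝔽
  open Degrees 𝔽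
  open Division 𝔽

  D : Set
  D = Digit P

  orbit : Pol → ℕ → Pol
  orbit w = Expansion.wₛ P Q w

  digit : Pol → ℕ → D
  digit w = Expansion.sₛ P Q w

  digits : Pol → ℕ → List D
  digits w = Expansion.digitsTo P Q w

  Vanishes : Pol → ℕ → Set
  Vanishes w = Expansion.VanishesAfter P Q w

  Expands : Pol → List D → Set
  Expands = IsDigitString P Q

  Step : Pol → D → Pol → Set
  Step y s y′ = Q ⊛ y′ ≋ (P ⊛ y) ⊕ toList s

  data Reach : Pol → List D → Pol → Set where
    done : ∀ {y} → Reach y [] y
    step : ∀ {y s y′ x z} → Step y s y′ → Reach y′ x z → Reach y (s ∷ x) z

  orbit-step : ∀ w i → Step (orbit w (suc i)) (digit w i) (orbit w i)
  orbit-step w i = divMod-correct P (Q ⊛ orbit w i) P≢0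

  orbit-shift : ∀ w m i → orbit (orbit w m) i ≡ orbit w (i +ₙ m)
  orbit-shift w m zero    = refl
  orbit-shift w m (suc i) = cong (λ y → quot P (Q ⊛ y)) (orbit-shift w m i)

  digit-shift : ∀ w m i → digit (orbit w m) i ≡ digit w (i +ₙ m)
  digit-shift w m i = cong (λ y → rem P (Q ⊛ y)) (orbit-shift w m i)

  lowDigits : Pol → ℕ → List D
  lowDigits w zero    = []
  lowDigits w (suc m) = digit w m ∷ lowDigits w m

  length-lowDigits : ∀ w m → length (lowDigits w m) ≡ m
  length-lowDigits w zero    = refl
  length-lowDigits w (suc m) = cong suc (length-lowDigits w m)

  length-digits : ∀ w k → length (digits w k) ≡ suc k
  length-digits w zero    = refl
  length-digits w (suc k) = cong suc (length-digits w k)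

  digits-split : ∀ w k m → digits w (k +ₙ m) ≡ digits (orbit w m) k ++ lowDigits w m
  digits-split w zero    zero    = refl
  digits-split w zero    (suc m) = cong (digit w (suc m) ∷_) (digits-split w zero m)
  digits-split w (suc k) m       = cong₂ _∷_ (sym (digit-shift w m (suc k))) (digits-split w k m)

  reach-lowDigits : ∀ w m → Reach (orbit w m) (lowDigits w m) w
  reach-lowDigits w zero    = done
  reach-lowDigits w (suc m) = step (orbit-step w m) (reach-lowDigits w m)

  vanishes-shift : ∀ w k m → Vanishes w (k +ₙ m) → Vanishes (orbit w m) k
  vanishes-shift w k m va i k<i =
    subst IsZero (sym (orbit-shift w m i)) (va (i +ₙ m) (+-monoˡ-< m k<i))

  vanishes-unshift : ∀ w k m → Vanishes (orbit w m) k → Vanishes w (k +ₙ m)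
  vanishes-unshift w k m va i k+m<i =
    subst IsZero (trans (orbit-shift w m (i ∸ m)) (cong (orbit w) (m∸n+n≡m m≤i))) (va (i ∸ m) k<i-m)
    where
    m≤i : m ≤ i
    m≤i = ≤-trans (m≤n+m m k) (<⇒≤ k+m<i)
    k<i-m : k < i ∸ m
    k<i-m = subst (_< i ∸ m) (m+n∸n≡m k m) (∸-monoˡ-< k+m<i (m≤n+m m k))

  expands-orbit : ∀ w k m → Expands w (digits w (k +ₙ m)) → Expands (orbit w m) (digits (orbit w m) k)
  expands-orbit w k m (k′ , eq , va , minimal) = k , refl , vanishes-shift w k m va′ , minimal′
    where
    k′≡ : k′ ≡ k +ₙ m
    k′≡ = suc-injective (trans (sym (length-digits w k′))
                               (trans (cong length (sym eq)) (length-digits w (k +ₙ m))))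
    va′ : Vanishes w (k +ₙ m)
    va′ = subst (Vanishes w) k′≡ va
    minimal′ : ∀ j → j < k → ¬ Vanishes (orbit w m) j
    minimal′ j j<k va-j = minimal (j +ₙ m) (subst (j +ₙ m <_) (sym k′≡) (+-monoˡ-< m j<k))
                                  (vanishes-unshift w j m va-j)

  -- Splitting an expansion: if  ⟨z⟩ = u x  with u nonempty, then  u = ⟨y⟩
  -- for the y from which reading x leads to z (namely y = z_{|x|}).
  decompose : ∀ z u x → u ≢ [] → Expands z (u ++ x) → Σ Pol λ y → Expands y u × Reach y x z
  decompose z []      x u≢[] _ = ⊥-elim (u≢[] refl)
  decompose z (d ∷ u) x _ ez@(k , eq , _) =
    orbit z m ,
    subst (Expands (orbit z m)) (sym (proj₁ split)) (expands-orbit z (length u) m ez′) ,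
    subst (λ l → Reach (orbit z m) l z) (sym (proj₂ split)) (reach-lowDigits z m)
    where
    m = length x
    k≡ : k ≡ length u +ₙ m
    k≡ = suc-injective (trans (sym (length-digits z k))
                              (trans (cong length (sym eq)) (cong suc (length-++ u))))
    word≡ : (d ∷ u) ++ x ≡ digits z (length u +ₙ m)
    word≡ = trans eq (cong (digits z) k≡)
    ez′ : Expands z (digits z (length u +ₙ m))
    ez′ = subst (Expands z) word≡ ez
    split : (d ∷ u ≡ digits (orbit z m) (length u)) × (x ≡ lowDigits z m)
    split = ++-split (d ∷ u) _ x _ (sym (length-digits (orbit z m) (length u)))
              (trans word≡ (digits-split z (length u) m))

  digits-nonempty : ∀ w k → digits w k ≢ []
  digits-nonempty w zero    ()
  digits-nonempty w (suc k) ()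

  expands-nonempty : ∀ {y u} → Expands y u → u ≢ []
  expands-nonempty {y} (k , eq , _) u≡[] = digits-nonempty y k (trans (sym eq) u≡[])

  orbit-cong : ∀ {y y′} → y ≋ y′ → ∀ i → orbit y i ≋ orbit y′ i
  orbit-cong e zero    = e
  orbit-cong e (suc i) = proj₁ (divMod-cong P P≢0 (⊛-congʳ Q (orbit-cong e i)))

  digit-cong : ∀ {y y′} → y ≋ y′ → ∀ i → digit y i ≡ digit y′ i
  digit-cong e i = proj₂ (divMod-cong P P≢0 (⊛-congʳ Q (orbit-cong e i)))

  digits-cong : ∀ {y y′} → y ≋ y′ → ∀ k → digits y k ≡ digits y′ k
  digits-cong e zero    = cong (_∷ []) (digit-cong e 0)
  digits-cong e (suc k) = cong₂ _∷_ (digit-cong e (suc k)) (digits-cong e k)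

  expands-cong : ∀ {y y′ u} → y ≋ y′ → Expands y u → Expands y′ u
  expands-cong e (k , eq , va , minimal) =
    k , trans eq (digits-cong e k) ,
    (λ i k<i → IsZero-cong (orbit-cong e i) (va i k<i)) ,
    (λ j j<k va′ → minimal j j<k (λ i j<i → IsZero-cong (≋-sym (orbit-cong e i)) (va′ i j<i)))

  expands-functional : ∀ {y u u′} → Expands y u → Expands y u′ → u ≡ u′
  expands-functional (k , eq , va , minimal) (k′ , eq′ , va′ , minimal′) with <-cmp k k′
  ... | tri< k<k′ _ _ = ⊥-elim (minimal′ k k<k′ va)
  ... | tri≈ _ refl _ = trans eq (sym eq′)
  ... | tri> _ _ k′<k = ⊥-elim (minimal k′ k′<k va′)

  orbit-zero-step : ∀ w i → orbit w i ≋ [] → orbit w (suc i) ≋ []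
  orbit-zero-step w i z =
    quot-small P (Q ⊛ orbit w i) P≢0
      (DegreeBelow-cong (≋-sym (≋-trans (⊛-congʳ Q z) (⊛-zeroʳ Q))) (λ n _ → refl))

  vanishes-from : ∀ w k → orbit w (suc k) ≋ [] → Vanishes w k
  vanishes-from w k z i k<i = ≋⇒≈ (go i k<i)
    where
    go : ∀ i → k < i → orbit w i ≋ []
    go (suc i) (s≤s k≤i) with m≤n⇒m<n∨m≡n k≤i
    ... | inj₁ k<i  = orbit-zero-step w i (go i k<i)
    ... | inj₂ refl = z

  expands-snoc : ∀ {y u s y′} → ¬ (y ≋ []) → Expands y u → Step y s y′ → Expands y′ (u ++ (s ∷ []))
  expands-snoc {y} {u} {s} {y′} y≢0 (k , eq , va , minimal) st =
    suc k , trans (cong (_++ (s ∷ [])) eq) (sym (digits-snoc k)) , va′ , minimal′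
    where
    first = divMod-unique P (Q ⊛ y′) y s P≢0 st
    orbit-next : ∀ i → orbit y′ (suc i) ≋ orbit y i
    orbit-next zero    = proj₁ first
    orbit-next (suc i) = proj₁ (divMod-cong P P≢0 (⊛-congʳ Q (orbit-next i)))
    digit-next : ∀ i → digit y′ (suc i) ≡ digit y i
    digit-next i = proj₂ (divMod-cong P P≢0 (⊛-congʳ Q (orbit-next i)))
    digits-snoc : ∀ k → digits y′ (suc k) ≡ digits y k ++ (s ∷ [])
    digits-snoc zero    = cong₂ _∷_ (digit-next 0) (cong (_∷ []) (proj₂ first))
    digits-snoc (suc k) = cong₂ _∷_ (digit-next (suc k)) (digits-snoc k)
    va′ : Vanishes y′ (suc k)
    va′ (suc i) (s≤s k<i) = IsZero-cong (≋-sym (orbit-next i)) (va i k<i)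
    minimal′ : ∀ j → j < suc k → ¬ Vanishes y′ j
    minimal′ zero    _         va-0 = y≢0 (≋-trans (≋-sym (orbit-next 0)) (≈⇒≋ (va-0 1 (s≤s z≤n))))
    minimal′ (suc j) (s≤s j<k) va-j =
      minimal j j<k (λ i j<i → IsZero-cong (orbit-next i) (va-j (suc i) (s≤s j<i)))

  expands-single : ∀ {y s} → Expands y (s ∷ []) → Q ⊛ y ≋ toList s
  expands-single {y} {s} (zero , eq , va , _) =
    ≋-trans (divMod-correct P (Q ⊛ y) P≢0)
      (≋-trans (⊕-cong (≋-trans (⊛-congʳ P (≈⇒≋ (va 1 (s≤s z≤n)))) (⊛-zeroʳ P)) ≋-refl)
               (≡⇒≋ (cong toList (sym (∷-injectiveˡ eq)))))
  expands-single {y} {s} (suc k , eq , _) = ⊥-elim (digits-nonempty y k (sym (∷-injectiveʳ eq)))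

  step-difference : ∀ {y s y₁ y′ y₁′} → Step y s y₁ → Step y′ s y₁′ →
                    Q ⊛ (y₁ ⊖ y₁′) ≋ P ⊛ (y ⊖ y′)
  step-difference {y} {s} {y₁} {y′} {y₁′} st st′ = begin
    Q ⊛ (y₁ ⊖ y₁′)                                  ≈⟨ ⊛-distribˡ-⊖ Q y₁ y₁′ ⟩
    (Q ⊛ y₁) ⊖ (Q ⊛ y₁′)                            ≈⟨ ⊕-cong st (scale-cong st′) ⟩
    ((P ⊛ y) ⊕ toList s) ⊖ ((P ⊛ y′) ⊕ toList s)    ≈⟨ ⊖-interchange (P ⊛ y) (P ⊛ y′) (toList s) (toList s) ⟨
    ((P ⊛ y) ⊖ (P ⊛ y′)) ⊕ (toList s ⊖ toList s)    ≈⟨ ⊕-cong ≋-refl (⊕-inverseʳ (toList s)) ⟩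
    ((P ⊛ y) ⊖ (P ⊛ y′)) ⊕ []                       ≈⟨ ⊕-identityʳ _ ⟩
    (P ⊛ y) ⊖ (P ⊛ y′)                              ≈⟨ ⊛-distribˡ-⊖ P y y′ ⟨
    P ⊛ (y ⊖ y′)                                    ∎
    where open ≋-Reasoning

  reach-difference : ∀ {y x z y′ z′} → Reach y x z → Reach y′ x z′ →
                     pow Q (length x) ⊛ (z ⊖ z′) ≋ pow P (length x) ⊛ (y ⊖ y′)
  reach-difference done done = ≋-refl
  reach-difference {y} {s ∷ x} {z} {y′} {z′} (step {y′ = y₁} st r) (step {y′ = y₁′} st′ r′) = begin
    (Q ⊛ Qⁿ) ⊛ (z ⊖ z′)       ≈⟨ ⊛-assoc Q Qⁿ (z ⊖ z′) ⟩
    Q ⊛ (Qⁿ ⊛ (z ⊖ z′))       ≈⟨ ⊛-congʳ Q (reach-difference r r′) ⟩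
    Q ⊛ (Pⁿ ⊛ (y₁ ⊖ y₁′))     ≈⟨ ⊛-left-comm Q Pⁿ (y₁ ⊖ y₁′) ⟩
    Pⁿ ⊛ (Q ⊛ (y₁ ⊖ y₁′))     ≈⟨ ⊛-congʳ Pⁿ (step-difference st st′) ⟩
    Pⁿ ⊛ (P ⊛ (y ⊖ y′))       ≈⟨ ⊛-left-comm Pⁿ P (y ⊖ y′) ⟩
    P ⊛ (Pⁿ ⊛ (y ⊖ y′))       ≈⟨ ⊛-assoc P Pⁿ (y ⊖ y′) ⟨
    (P ⊛ Pⁿ) ⊛ (y ⊖ y′)       ∎
    where
    open ≋-Reasoning
    Qⁿ = pow Q (length x)
    Pⁿ = pow P (length x)

  reach-deterministic : ∀ {y y′ x z z′} → Reach y x z → Reach y′ x z′ → y ≋ y′ → z ≋ z′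
  reach-deterministic {y} {y′} {x} {z} {z′} r r′ y≋y′ with ≋[]? (z ⊖ z′)
  ... | yes z-z′≋0 = ⊖≋[]⇒≋ z z′ z-z′≋0
  ... | no  z-z′≢0 = ⊥-elim (⊛-≢0 (pow-≢0 Q≢0 (length x)) z-z′≢0
          (≋-trans (reach-difference r r′) (≋-trans (⊛-congʳ Pⁿ (≋⇒⊖≋[] y≋y′)) (⊛-zeroʳ Pⁿ))))
    where Pⁿ = pow P (length x)

  -- Distinct polynomials have distinct expansions: the first digit s of
  -- ⟨y⟩ = s x determines y_k = s/Q, and reading x then determines y.
  expands-injective : ∀ {y y′ u} → Expands y u → Expands y′ u → y ≋ y′
  expands-injective {u = []}    ey _ = ⊥-elim (expands-nonempty ey refl)
  expands-injective {y} {y′} {s ∷ x} ey ey′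
    with decompose y (s ∷ []) x (λ ()) ey | decompose y′ (s ∷ []) x (λ ()) ey′
  ... | y₀ , ey₀ , r | y₀′ , ey₀′ , r′ =
    reach-deterministic r r′ (⊛-cancelˡ Q≢0 (≋-trans (expands-single ey₀) (≋-sym (expands-single ey₀′))))

  prefix-closed : PrefixClosed (Lang P Q)
  prefix-closed u v (w , ew) u≢[] = proj₁ d , proj₁ (proj₂ d)
    where d = decompose w u v u≢[] ew

-- When deg Q < deg P, every expansion can be continued: from y ≠ 0, the
-- digit s ≡ −P y (mod Q) (of degree < deg Q < deg P) leads to the nonzero
-- y′ = (P y + s)/Q.  Starting from 1 (whose expansion is the single digit
-- Q) this yields polynomials g_n whose expansions G_n extend each other.
module GreedyContinuation (𝔽 : FiniteField) (P Q : Poly.Pol 𝔽)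
    (P≢0 : ¬ Arithmetic._≋_ 𝔽 P []) (Q≢0 : ¬ Arithmetic._≋_ 𝔽 Q [])
    (degQ<degP : Poly.deg 𝔽 Q < Poly.deg 𝔽 P) where
  open FiniteField 𝔽
  open Poly 𝔽
  open Arithmetic 𝔽
  open Degrees 𝔽
  open Division 𝔽
  open DigitExpansions 𝔽 P Q P≢0 Q≢0

  expands-1 : Expands 1p (digits 1p 0)
  expands-1 = 0 , refl , vanishes-from 1p 0 (quot-small P (Q ⊛ 1p) P≢0 Q<degP) , λ _ ()
    where
    Q<degP : DegreeBelow (deg P) (Q ⊛ 1p)
    Q<degP = DegreeBelow-cong (≋-sym (≋-trans (⊛-comm Q 1p) (⊛-identityˡ Q)))
               (DegreeBelow-mono Q degQ<degP (DegreeBelow-deg Q))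

  complement : Pol → D
  complement A = toVec (deg P) (neg (toList (rem Q A)))

  complement-correct : ∀ A → toList (complement A) ≋ neg (toList (rem Q A))
  complement-correct A = toVec-correct (deg P) (neg (toList (rem Q A)))
    (DegreeBelow-scale (- 1#) (toList (rem Q A)) (DegreeBelow-mono (toList (rem Q A)) (<⇒≤ degQ<degP) (DegreeBelow-vec (rem Q A))))

  ⊕-complement : ∀ A → A ⊕ toList (complement A) ≋ Q ⊛ quot Q A
  ⊕-complement A = ≋-trans (⊕-cong (divMod-correct Q A Q≢0) (complement-correct A))
                           (⊕⊖-cancel (toList (rem Q A)) (Q ⊛ quot Q A))

  nextDigit : Pol → D
  nextDigit y = complement (P ⊛ y)

  next : Pol → Pol
  next y = quot Q (P ⊛ y)

  step-next : ∀ y → Step y (nextDigit y) (next y)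
  step-next y = ≋-sym (⊕-complement (P ⊛ y))

  next-≢0 : ∀ {y} → ¬ (y ≋ []) → ¬ (next y ≋ [])
  next-≢0 {y} y≢0 z = y≢0 (quotient-vanishes (HasDegree-deg P P≢0) y (toList (nextDigit y))
    (DegreeBelow-vec (nextDigit y)) (≋-trans (⊕-complement (P ⊛ y)) (≋-trans (⊛-congʳ Q z) (⊛-zeroʳ Q))))

  g : ℕ → Pol
  g zero    = 1p
  g (suc n) = next (g n)

  G : ℕ → List D
  G zero    = digits 1p 0
  G (suc n) = G n ++ (nextDigit (g n) ∷ [])

  g-≢0 : ∀ n → ¬ (g n ≋ [])
  g-≢0 zero    = 1p≢0
  g-≢0 (suc n) = next-≢0 (g-≢0 n)

  g-expands : ∀ n → Expands (g n) (G n)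
  g-expands zero    = expands-1
  g-expands (suc n) = expands-snoc (g-≢0 n) (g-expands n) (step-next (g n))

  length-G : ∀ n → length (G n) ≡ suc n
  length-G zero    = refl
  length-G (suc n) = trans (length-++ (G n)) (trans (+-comm (length (G n)) 1) (cong suc (length-G n)))

  segment : ℕ → ℕ → List D
  segment a zero    = []
  segment a (suc t) = nextDigit (g a) ∷ segment (suc a) t

  length-segment : ∀ a t → length (segment a t) ≡ t
  length-segment a zero    = refl
  length-segment a (suc t) = cong suc (length-segment (suc a) t)

  G-++-segment : ∀ a t → G a ++ segment a t ≡ G (a +ₙ t)
  G-++-segment a zero    = trans (++-identityʳ (G a)) (cong G (sym (+-identityʳ a)))
  G-++-segment a (suc t) = begin
    G a ++ (nextDigit (g a) ∷ segment (suc a) t)   ≡⟨ ++-assoc (G a) (nextDigit (g a) ∷ []) _ ⟨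
    G (suc a) ++ segment (suc a) t                 ≡⟨ G-++-segment (suc a) t ⟩
    G (suc a +ₙ t)                                 ≡⟨ cong G (+-suc a t) ⟨
    G (a +ₙ suc t)                                 ∎
    where open ≡-Reasoning

  reach-segment : ∀ a t → Reach (g a) (segment a t) (g (a +ₙ t))
  reach-segment a zero    = subst (λ k → Reach (g a) [] (g k)) (sym (+-identityʳ a)) done
  reach-segment a (suc t) = step (step-next (g a))
    (subst (λ k → Reach (g (suc a)) (segment (suc a) t) (g k)) (sym (+-suc a t)) (reach-segment (suc a) t))

module Irregularity (𝔽 : FiniteField) (P Q : Poly.Pol 𝔽)
    (P≢0 : ¬ Arithmetic._≋_ 𝔽 P []) (Q≢0 : ¬ Arithmetic._≋_ 𝔽 Q [])
    (degQ<degP : Poly.deg 𝔽 Q < Poly.deg 𝔽 P)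
    (coprime : Poly.Coprime 𝔽 P Q) (1≤degQ : 1 ≤ Poly.deg 𝔽 Q) where
  open FiniteField 𝔽
  open Poly 𝔽
  open Arithmetic 𝔽
  open Degrees 𝔽
  open Divisibility 𝔽
  open DigitExpansions 𝔽 P Q P≢0 Q≢0
  open GreedyContinuation 𝔽 P Q P≢0 Q≢0 degQ<degP

  deg-pow : ∀ m → m ≤ deg (pow Q m)
  deg-pow zero    = z≤n
  deg-pow (suc m) = subst (suc m ≤_) (sym (deg-⊛ Q≢0 (pow-≢0 Q≢0 m))) (+-mono-≤ 1≤degQ (deg-pow m))

  -- If G_a followed by the m digits after G_b is an expansion, then
  -- Q^m ∣ g_b − g_a: the two readings of these digits, from g_a and from
  -- g_b, give  Q^m (g_{b+m} − z) = P^m (g_b − g_a)  and Q is coprime to P.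
  continuation-divides : ∀ a b m → Lang P Q (G a ++ segment b m) → pow Q m divides (g b ⊖ g a)
  continuation-divides a b m (z , ez) with decompose z (G a) (segment b m) (expands-nonempty (g-expands a)) ez
  ... | y , ey , reach-z =
    coprime-powers {P} {Q} coprime Q≢0 m m (g b ⊖ g a) (g (b +ₙ m) ⊖ z) (begin
      pow Q m ⊛ (g (b +ₙ m) ⊖ z)   ≈⟨ subst (λ k → pow Q k ⊛ (g (b +ₙ m) ⊖ z) ≋ pow P k ⊛ (g b ⊖ y))
                                             (length-segment b m) (reach-difference (reach-segment b m) reach-z) ⟩
      pow P m ⊛ (g b ⊖ y)          ≈⟨ ⊛-congʳ (pow P m) (⊕-cong ≋-refl (scale-cong (expands-injective ey (g-expands a)))) ⟩
      pow P m ⊛ (g b ⊖ g a)        ∎)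
    where open ≋-Reasoning

  G-separated : ∀ {a b} → a < b → Σ (List D) λ x → Lang P Q (G b ++ x) × ¬ Lang P Q (G a ++ x)
  G-separated {a} {b} a<b = segment b m , accepted , rejected
    where
    e = g b ⊖ g a
    m = suc (deg e)
    e≢0 : ¬ (e ≋ [])
    e≢0 e≋0 = <-irrefl (suc-injective (begin
      suc a            ≡⟨ length-G a ⟨
      length (G a)     ≡⟨ cong length (expands-functional (g-expands a) (expands-cong gb≋ga (g-expands b))) ⟩
      length (G b)     ≡⟨ length-G b ⟩
      suc b            ∎)) a<b
      where
      open ≡-Reasoning
      gb≋ga = ⊖≋[]⇒≋ (g b) (g a) e≋0
    accepted : Lang P Q (G b ++ segment b m)
    accepted = g (b +ₙ m) , subst (Expands (g (b +ₙ m))) (sym (G-++-segment b m)) (g-expands (b +ₙ m))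
    rejected : ¬ Lang P Q (G a ++ segment b m)
    rejected La = <-irrefl refl
      (≤-trans (deg-pow m) (divides⇒deg≤ e≢0 (continuation-divides a b m La)))

  not-regular : ¬ Regular (Lang P Q)
  not-regular = separated⇒¬regular (Lang P Q) G G-separated

  -- ⟨g_1⟩ = Q s with s ≡ −P (mod Q); if the suffix s were an expansion
  -- ⟨t⟩, then Q t = s, so Q ∣ P and Q would be a unit.
  not-suffix-closed : ¬ SuffixClosed (Lang P Q)
  not-suffix-closed suffix-closed = <-irrefl refl (≤-trans 1≤degQ (subst (deg Q ≤_) deg-1p degQ≤deg1))
    where
    s = nextDigit 1p
    t = proj₁ (suffix-closed (G 0) (s ∷ []) (g 1 , g-expands 1) (λ ()))
    Qt≋s : Q ⊛ t ≋ toList s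
    Qt≋s = expands-single (proj₂ (suffix-closed (G 0) (s ∷ []) (g 1 , g-expands 1) (λ ())))
    Q∣P1+s : Q divides (P ⊛ 1p) ⊕ toList s
    Q∣P1+s = g 1 , ≋-trans (⊛-comm (g 1) Q) (step-next 1p)
    Q∣P : Q divides P
    Q∣P = divides-cong (≋-trans (⊕⊖-cancel (toList s) (P ⊛ 1p)) (≋-trans (⊛-comm P 1p) (⊛-identityˡ P)))
            (divides-⊕ Q∣P1+s (divides-neg (t , ≋-trans (⊛-comm t Q) Qt≋s)))
    degQ≤deg1 : deg Q ≤ deg 1p
    degQ≤deg1 = divides⇒deg≤ 1p≢0 (∣⇒divides (coprime Q (divides⇒∣ Q∣P) (divides⇒∣ (divides-refl Q))))

theorem3p2 : (𝔽 : FiniteField) (P Q : Poly.Pol 𝔽) →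
    ¬ Poly.IsZero 𝔽 P → ¬ Poly.IsZero 𝔽 Q → Poly.Coprime 𝔽 P Q →
    Poly.deg 𝔽 Q < Poly.deg 𝔽 P →
    ((1 ≤ Poly.deg 𝔽 Q →
        ¬ Regular (Poly.Lang 𝔽 P Q) × ¬ SuffixClosed (Poly.Lang 𝔽 P Q))
     × PrefixClosed (Poly.Lang 𝔽 P Q))
theorem3p2 𝔽 P Q P≠0 Q≠0 coprime degQ<degP =
  (λ 1≤degQ → Irregular.not-regular 1≤degQ , Irregular.not-suffix-closed 1≤degQ) ,
  DigitExpansions.prefix-closed 𝔽 P Q P≢0 Q≢0
  where
  open Arithmetic 𝔽 using (_≋_)
  open Degrees 𝔽 using (≋⇒≈)
  P≢0 : ¬ (P ≋ [])
  P≢0 = P≠0 ∘ ≋⇒≈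
  Q≢0 : ¬ (Q ≋ [])
  Q≢0 = Q≠0 ∘ ≋⇒≈
  module Irregular = Irregularity 𝔽 P Q P≢0 Q≢0 degQ<degP coprime
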